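{- Let $G$ and $G'$ be two graphs on the same set $V$ of $v$ vertices. Let $p$ be a prime number and $k$ an integer with $4\leq k\leq v-4$. 1) If $p^{(4)}(G_{\restriction K})=p^{(4)}(G'_{\restriction K})$ for all $k$-element subsets $K$ of $V$, then $G$ and $G'$ have the same indecomposable sets of size $4$. 2) Assume $p^{(4)}(G_{\restriction K})\equiv p^{(4)}(G'_{\restriction K}) \pmod p$ for all $k$-element subsets $K$ of $V$. a) If $p\geq 5$ and $k\not\equiv 1,2,3 \pmod p$, then $G$ and $G'$ have the same indecomposable sets of size $4$. b) If ($p=2$, $4\mid k$ and $8\nmid k$) or ($p=3$, $3\mid k-1$ and $9\nmid k-1$), then $G$ and $G'$ have the same indecomposable sets of size $4$. c) If $p=2$ and $8\mid k$, then $G$ and $G'$ have the same indecomposable sets of size $4$, or for all $4$-element subsets $T$ of $V$, $G_{\restriction T}$ is indecomposable if and only if $G'_{\restriction T}$ is decomposable.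
   Context: Graphs are simple undirected graphs; $G_{\restriction K}$ is the induced subgraph on $K$. A subset $I$ of the vertex set of a graph is an interval if for all $a,b\in I$ and all vertices $x\notin I$, $\{a,x\}$ is an edge iff $\{b,x\}$ is an edge. The sets $\emptyset$, singletons and the whole vertex set are trivial intervals; a graph is indecomposable if all its intervals are trivial, decomposable otherwise. An indecomposable set of size $4$ of $G$ is a $4$-element subset $T$ with $G_{\restriction T}$ indecomposable (equivalently, $G_{\restriction T}$ isomorphic to the path $P_4$ with edges $\{0,1\},\{1,2\},\{2,3\}$). $p^{(4)}(G)$ denotes the number of $4$-element subsets $T$ of the vertex set with $G_{\restriction T}$ indecomposable. -}

module Defs where

open import Data.Nat using (ℕ; zero; suc)
open import Data.Bool using (Bool; true; false)
open import Data.Fin using (Fin)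
open import Data.Fin.Subset using (Subset; _∈_; _∉_; _⊆_; ⁅_⁆; ∣_∣; inside; outside)
open import Data.List using (List; []; _∷_; _++_; map; filter; length)
open import Data.Vec using (Vec; []; _∷_)
open import Data.Product using (∃; _×_)
open import Data.Sum using (_⊎_)
open import Relation.Nullary using (¬_; Dec)
open import Relation.Unary using (Decidable)
open import Relation.Binary.PropositionalEquality using (_≡_)
import Data.Integer as ℤ
import Data.Integer.Divisibility as ℤD

record Graph (v : ℕ) : Set where
  field
    adj   : Fin v → Fin v → Bool
    sym   : ∀ x y → adj x y ≡ adj y x
    irrefl : ∀ x → adj x x ≡ false
open Graph public

IsInterval : ∀ {v} → Graph v → Subset v → Subset v → Set
IsInterval G K I =
  I ⊆ K × (∀ a b x → a ∈ I → b ∈ I → x ∈ K → x ∉ I → adj G a x ≡ adj G b x)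

IsTrivial : ∀ {v} → Subset v → Subset v → Set
IsTrivial K I = (∀ x → x ∉ I) ⊎ (∃ λ x → I ≡ ⁅ x ⁆) ⊎ I ≡ K

Indecomposable : ∀ {v} → Graph v → Subset v → Set
Indecomposable G K = ∀ I → IsInterval G K I → IsTrivial K I

allSubsets : (v : ℕ) → List (Subset v)
allSubsets zero = [] ∷ []
allSubsets (suc v) = map (inside ∷_) (allSubsets v) ++ map (outside ∷_) (allSubsets v)

IndecSet4 : ∀ {v} → Graph v → Subset v → Subset v → Set
IndecSet4 G K T = T ⊆ K × ∣ T ∣ ≡ 4 × Indecomposable G T

_≡_[mod_] : ℕ → ℕ → ℕ → Set
a ≡ b [mod m ] = (ℤ.+ m) ℤD.∣ ((ℤ.+ a) ℤ.- (ℤ.+ b))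

private
  open import Data.Fin.Properties using (all?; any?)
  open import Data.Fin.Subset.Properties using (_∈?_; _⊆?_; anySubset?)
  open import Data.Vec.Properties using (≡-dec)
  import Data.Bool as B
  open import Relation.Nullary using (yes; no; ¬?; _×-dec_; _⊎-dec_; _→-dec_)
  open import Relation.Nullary.Decidable using (decidable-stable)
  open import Data.Product using (_,_)

  allSubset? : ∀ {v} {P : Subset v → Set} → Decidable P → Dec (∀ I → P I)
  allSubset? {P = P} P? with anySubset? (λ I → ¬? (P? I))
  ... | yes (I , ¬p) = no λ f → ¬p (f I)
  ... | no ¬∃ = yes λ I → decidable-stable (P? I) λ ¬p → ¬∃ (I , ¬p)

  isInterval? : ∀ {v} (G : Graph v) K → Decidable (IsInterval G K)
  isInterval? G K I = (I ⊆? K) ×-dec all? λ a → all? λ b → all? λ x →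
    (a ∈? I) →-dec ((b ∈? I) →-dec ((x ∈? K) →-dec (¬? (x ∈? I) →-dec (adj G a x B.≟ adj G b x))))

  isTrivial? : ∀ {v} K → Decidable (IsTrivial {v} K)
  isTrivial? K I = all? (λ x → ¬? (x ∈? I))
    ⊎-dec (any? (λ x → ≡-dec B._≟_ I ⁅ x ⁆) ⊎-dec ≡-dec B._≟_ I K)

indecomposable? : ∀ {v} (G : Graph v) → Decidable (Indecomposable G)
indecomposable? G K = allSubset? λ I → isInterval? G K I →-dec isTrivial? K I

indecSet4? : ∀ {v} (G : Graph v) K → Decidable (IndecSet4 G K)
indecSet4? G K T = (T ⊆? K) ×-dec ((∣ T ∣ ≟ 4) ×-dec indecomposable? G T)
  where open import Data.Nat using (_≟_)

p4 : ∀ {v} → Graph v → Subset v → ℕ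
p4 {v} G K = length (filter (indecSet4? G K) (allSubsets v))

module Submission where

-- Let F(T) = [G|T indecomposable] − [G'|T indecomposable] for 4-sets T, and 0 elsewhere.  The
-- hypothesis says that M divides ∑_{T ⊆ K} F(T) for every k-set K, with M = 0 or M = p.  Inside
-- a (k+4)-set U we study the window sums W(A, B) = ∑_{A ⊆ T ⊆ U∖B} F(T): each W(∅, R) with
-- |R| = 4 is a hypothesis sum, and double counting gives ∑_{B ⊆ R ⊆ U, |R| = 4} W(∅, R) =
-- C(k−|B|, 4−|B|)·W(∅, B).  If M cancels these binomial coefficients, inclusion–exclusion
-- (W(A, B) = W(A∪x, B) + W(A, B∪x)) yields F(T) = W(T, ∅) ≡ W(∅, ∅) (mod M) for all 4-sets
-- T ⊆ U, and M ∣ C(k, 4)·W(∅, ∅).  So F is constant mod M on 4-sets, and vanishes mod M if M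
-- also cancels C(k, 4).  Every graph on six vertices has a decomposable 4-set, so a constant F
-- with values in {−1, 0, 1} must vanish modulo M ∤ 1, 2, while modulo 2 it only says that G and
-- G' agree on all 4-sets or disagree on all of them.  The conditions on p and k in the four
-- cases are what makes p avoid the binomial coefficients (via the absorption identity).

module SubsetSums where

  open import Data.Nat using (zero; suc)
  open import Data.Bool using (Bool; true; false; _∧_)
  open import Data.Vec using (_∷_; [])
  open import Data.Fin.Subset using (Subset; inside; outside)
  open import Data.Integer using (ℤ; +_; _+_; _*_; -_; _-_)
  open import Data.Integer.Properties
    using (*-identityˡ; *-distribˡ-+; +-identityˡ; +-identityʳ; +-assoc; -1*i≡-i)
  open import Data.Integer.Tactic.RingSolver using (solve-∀)
  open import Data.Integer.Divisibility.Signed using (_∣_; ∣m∣n⇒∣m+n)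
  open import Data.List using (List; []; _∷_; _++_; map; filter; length)
  open import Data.List.Properties using (map-++; map-∘)
  open import Relation.Nullary using (does)
  open import Relation.Unary using (Decidable)
  open import Relation.Binary.PropositionalEquality
  open import Data.Vec.Properties using (∷-injectiveʳ)
  open import Function using (_∘_)
  open import Defs using (allSubsets)

  ⟦_⟧ : Bool → ℤ
  ⟦ true ⟧ = + 1
  ⟦ false ⟧ = + 0

  ⟦⟧-∧ : ∀ a b → ⟦ a ∧ b ⟧ ≡ ⟦ a ⟧ * ⟦ b ⟧
  ⟦⟧-∧ true b = sym (*-identityˡ ⟦ b ⟧)
  ⟦⟧-∧ false b = refl

  ∑ : ∀ {v} → (Subset v → ℤ) → ℤ
  ∑ {zero} f = f []
  ∑ {suc v} f = ∑ (λ X → f (inside ∷ X)) + ∑ (λ X → f (outside ∷ X))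

  syntax ∑ (λ X → e) = ∑[ X ] e

  ∑-cong : ∀ {v} {f g : Subset v → ℤ} → (∀ X → f X ≡ g X) → ∑ f ≡ ∑ g
  ∑-cong {zero} f≗g = f≗g []
  ∑-cong {suc v} f≗g = cong₂ _+_ (∑-cong (λ X → f≗g (inside ∷ X))) (∑-cong (λ X → f≗g (outside ∷ X)))

  ∑-+ : ∀ {v} (f g : Subset v → ℤ) → ∑[ X ] (f X + g X) ≡ ∑ f + ∑ g
  ∑-+ {zero} f g = refl
  ∑-+ {suc v} f g = begin
    ∑[ X ] (f (inside ∷ X) + g (inside ∷ X)) + ∑[ X ] (f (outside ∷ X) + g (outside ∷ X))
      ≡⟨ cong₂ _+_ (∑-+ (λ X → f (inside ∷ X)) _) (∑-+ (λ X → f (outside ∷ X)) _) ⟩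
    (∑[ X ] f (inside ∷ X) + ∑[ X ] g (inside ∷ X)) + (∑[ X ] f (outside ∷ X) + ∑[ X ] g (outside ∷ X))
      ≡⟨ interchange (∑[ X ] f (inside ∷ X)) (∑[ X ] g (inside ∷ X))
                     (∑[ X ] f (outside ∷ X)) (∑[ X ] g (outside ∷ X)) ⟩
    ∑ f + ∑ g ∎
    where
    open ≡-Reasoning
    interchange : ∀ a b c d → (a + b) + (c + d) ≡ (a + c) + (b + d)
    interchange = solve-∀

  ∑-*ˡ : ∀ {v} c (f : Subset v → ℤ) → ∑[ X ] (c * f X) ≡ c * ∑ f
  ∑-*ˡ {zero} c f = refl
  ∑-*ˡ {suc v} c f = trans (cong₂ _+_ (∑-*ˡ c (λ X → f (inside ∷ X))) (∑-*ˡ c (λ X → f (outside ∷ X))))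
                           (sym (*-distribˡ-+ c _ _))

  ∑-- : ∀ {v} (f g : Subset v → ℤ) → ∑[ X ] (f X - g X) ≡ ∑ f - ∑ g
  ∑-- f g = begin
    ∑[ X ] (f X - g X)            ≡⟨ ∑-+ f (λ X → - g X) ⟩
    ∑ f + ∑[ X ] (- g X)          ≡⟨ cong (λ z → ∑ f + z) (∑-cong (λ X → sym (-1*i≡-i (g X)))) ⟩
    ∑ f + ∑[ X ] (- + 1 * g X)    ≡⟨ cong (λ z → ∑ f + z) (trans (∑-*ˡ (- + 1) g) (-1*i≡-i (∑ g))) ⟩
    ∑ f - ∑ g ∎
    where open ≡-Reasoning

  ∑-zero : ∀ {v} (f : Subset v → ℤ) → (∀ X → f X ≡ + 0) → ∑ f ≡ + 0
  ∑-zero {zero} f f≡0 = f≡0 []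
  ∑-zero {suc v} f f≡0 =
    cong₂ _+_ (∑-zero _ (λ X → f≡0 (inside ∷ X))) (∑-zero _ (λ X → f≡0 (outside ∷ X)))

  ∑-swap : ∀ {v w} (f : Subset v → Subset w → ℤ) → ∑[ X ] ∑[ Y ] f X Y ≡ ∑[ Y ] ∑[ X ] f X Y
  ∑-swap {zero} f = refl
  ∑-swap {suc v} f = trans (cong₂ _+_ (∑-swap (λ X → f (inside ∷ X))) (∑-swap (λ X → f (outside ∷ X))))
    (sym (∑-+ (λ Y → ∑[ X ] f (inside ∷ X) Y) (λ Y → ∑[ X ] f (outside ∷ X) Y)))

  ∑-∣ : ∀ {v} M (f : Subset v → ℤ) → (∀ X → M ∣ f X) → M ∣ ∑ f
  ∑-∣ {zero} M f M∣f = M∣f []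
  ∑-∣ {suc v} M f M∣f = ∣m∣n⇒∣m+n (∑-∣ M _ (λ X → M∣f (inside ∷ X))) (∑-∣ M _ (λ X → M∣f (outside ∷ X)))

  ∑-single : ∀ {v} (T : Subset v) (f : Subset v → ℤ) → (∀ X → X ≢ T → f X ≡ + 0) → ∑ f ≡ f T
  ∑-single {zero} [] f f≡0 = refl
  ∑-single {suc v} (true ∷ T) f f≡0 =
    trans (cong₂ _+_ (∑-single T (λ X → f (inside ∷ X)) (λ X X≢T → f≡0 _ (X≢T ∘ ∷-injectiveʳ)))
                     (∑-zero _ (λ X → f≡0 (outside ∷ X) λ ())))
          (+-identityʳ _)
  ∑-single {suc v} (false ∷ T) f f≡0 =
    trans (cong₂ _+_ (∑-zero _ (λ X → f≡0 (inside ∷ X) λ ()))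
                     (∑-single T (λ X → f (outside ∷ X)) (λ X X≢T → f≡0 _ (X≢T ∘ ∷-injectiveʳ))))
          (+-identityˡ _)

  sumℤ : List ℤ → ℤ
  sumℤ [] = + 0
  sumℤ (x ∷ xs) = x + sumℤ xs

  sumℤ-++ : ∀ xs ys → sumℤ (xs ++ ys) ≡ sumℤ xs + sumℤ ys
  sumℤ-++ [] ys = sym (+-identityˡ _)
  sumℤ-++ (x ∷ xs) ys = trans (cong (λ s → x + s) (sumℤ-++ xs ys)) (sym (+-assoc x _ _))

  length-filter : ∀ {A : Set} {P : A → Set} (P? : Decidable P) xs →
    + length (filter P? xs) ≡ sumℤ (map (λ x → ⟦ does (P? x) ⟧) xs)
  length-filter P? [] = refl
  length-filter P? (x ∷ xs) with does (P? x)
  ... | false = trans (length-filter P? xs) (sym (+-identityˡ _))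
  ... | true = cong (λ s → + 1 + s) (length-filter P? xs)

  sumℤ-allSubsets : ∀ {v} (f : Subset v → ℤ) → sumℤ (map f (allSubsets v)) ≡ ∑ f
  sumℤ-allSubsets {zero} f = +-identityʳ _
  sumℤ-allSubsets {suc v} f = begin
    sumℤ (map f (map (inside ∷_) A ++ map (outside ∷_) A))
      ≡⟨ cong sumℤ (map-++ f (map (inside ∷_) A) _) ⟩
    sumℤ (map f (map (inside ∷_) A) ++ map f (map (outside ∷_) A))
      ≡⟨ sumℤ-++ (map f (map (inside ∷_) A)) _ ⟩
    sumℤ (map f (map (inside ∷_) A)) + sumℤ (map f (map (outside ∷_) A))
      ≡⟨ cong₂ _+_ (cong sumℤ (sym (map-∘ A))) (cong sumℤ (sym (map-∘ A))) ⟩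
    sumℤ (map (λ X → f (inside ∷ X)) A) + sumℤ (map (λ X → f (outside ∷ X)) A)
      ≡⟨ cong₂ _+_ (sumℤ-allSubsets (λ X → f (inside ∷ X))) (sumℤ-allSubsets (λ X → f (outside ∷ X))) ⟩
    ∑ f ∎
    where
    open ≡-Reasoning
    A : List (Subset v)
    A = allSubsets v

  count-as-∑ : ∀ {v} {P : Subset v → Set} (P? : Decidable P) →
    + length (filter P? (allSubsets v)) ≡ ∑[ X ] ⟦ does (P? X) ⟧
  count-as-∑ {v} P? = trans (length-filter P? (allSubsets v)) (sumℤ-allSubsets (λ X → ⟦ does (P? X) ⟧))

module BitSubsets where

  open import Data.Nat using (ℕ; zero; suc; z≤n; s≤s; _≤_; _+_)
  open import Data.Nat.Properties
    using (≤-trans; ≤-reflexive; <-irrefl; <-≤-trans; m≤n⇒m≤1+n; +-suc; suc-injective; _≤?_; ≰⇒>;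
           +-monoʳ-≤; n≤1+n; m≤n⇒m≤o+n)
  open import Data.Bool using (Bool; true; false; _∧_; _∨_; not)
  open import Data.Bool.Properties using (∧-assoc; ∧-identityʳ; ∧-zeroʳ)
  open import Data.Vec using ([]; _∷_; lookup; _[_]≔_)
  open import Data.Vec.Properties using (lookup∘update; lookup∘update′; []≔-lookup; lookup-replicate)
  open import Data.Fin using (Fin; zero; suc)
  open import Data.Fin.Subset using (Subset; inside; outside; ∣_∣; ⊥; _⊆_; _─_; _∪_)
  open import Data.Fin.Subset.Properties using (_⊆?_; p⊆q⇒∣p∣≤∣q∣; ∣p∣≤n; ⊆-refl; ⊆-trans; ⊥⊆; p⊆p∪q; q⊆p∪q)
  open import Data.Product using (Σ; _×_; _,_)
  open import Data.Sum using (_⊎_; inj₁; inj₂)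
  open import Data.Fin.Properties using (_≟_)
  open import Data.Empty using (⊥-elim)
  open import Relation.Nullary using (does; yes; no)
  open import Relation.Nullary.Decidable using (dec-true)
  open import Function using (_∘_)
  open import Relation.Binary.PropositionalEquality

  private variable v : ℕ

  _⊆ᵇ_ : Subset v → Subset v → Bool
  [] ⊆ᵇ [] = true
  (a ∷ A) ⊆ᵇ (b ∷ B) = (not a ∨ b) ∧ (A ⊆ᵇ B)

  infix 4.5 _⊆ᵇ_

  ⊆ᵇ-does : (A B : Subset v) → does (A ⊆? B) ≡ A ⊆ᵇ B
  ⊆ᵇ-does [] [] = refl
  ⊆ᵇ-does (false ∷ A) (b ∷ B) = ⊆ᵇ-does A B
  ⊆ᵇ-does (true ∷ A) (false ∷ B) = refl
  ⊆ᵇ-does (true ∷ A) (true ∷ B) = ⊆ᵇ-does A B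

  -- Hence _⊆ᵇ_ reflects _⊆_, and the library's facts about _⊆_ transfer to it.
  ⊆ᵇ-sound : (A B : Subset v) → A ⊆ᵇ B ≡ true → A ⊆ B
  ⊆ᵇ-sound A B A⊆ᵇB with A ⊆? B | ⊆ᵇ-does A B
  ... | yes A⊆B | _ = A⊆B
  ... | no _ | false≡A⊆ᵇB with trans false≡A⊆ᵇB A⊆ᵇB
  ...   | ()

  ⊆ᵇ-complete : (A B : Subset v) → A ⊆ B → A ⊆ᵇ B ≡ true
  ⊆ᵇ-complete A B A⊆B = trans (sym (⊆ᵇ-does A B)) (dec-true (A ⊆? B) A⊆B)

  ⊆ᵇ-refl : (A : Subset v) → A ⊆ᵇ A ≡ true
  ⊆ᵇ-refl A = ⊆ᵇ-complete A A ⊆-refl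

  ⊆ᵇ-trans : (A B C : Subset v) → A ⊆ᵇ B ≡ true → B ⊆ᵇ C ≡ true → A ⊆ᵇ C ≡ true
  ⊆ᵇ-trans A B C A⊆B B⊆C = ⊆ᵇ-complete A C (⊆-trans (⊆ᵇ-sound A B A⊆B) (⊆ᵇ-sound B C B⊆C))

  ⊥-⊆ᵇ : (A : Subset v) → ⊥ ⊆ᵇ A ≡ true
  ⊥-⊆ᵇ A = ⊆ᵇ-complete ⊥ A ⊥⊆

  ⊆ᵇ-∪ˡ : (A B : Subset v) → A ⊆ᵇ A ∪ B ≡ true
  ⊆ᵇ-∪ˡ A B = ⊆ᵇ-complete A (A ∪ B) (p⊆p∪q B)

  ⊆ᵇ-∪ʳ : (A B : Subset v) → B ⊆ᵇ A ∪ B ≡ true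
  ⊆ᵇ-∪ʳ A B = ⊆ᵇ-complete B (A ∪ B) (q⊆p∪q A B)

  card-mono : (A B : Subset v) → A ⊆ᵇ B ≡ true → ∣ A ∣ ≤ ∣ B ∣
  card-mono A B = p⊆q⇒∣p∣≤∣q∣ ∘ ⊆ᵇ-sound A B

  card-equal : (A B : Subset v) → A ⊆ᵇ B ≡ true → ∣ B ∣ ≤ ∣ A ∣ → A ≡ B
  card-equal [] [] _ _ = refl
  card-equal (false ∷ A) (false ∷ B) A⊆B ∣B∣≤∣A∣ = cong (false ∷_) (card-equal A B A⊆B ∣B∣≤∣A∣)
  card-equal (false ∷ A) (true ∷ B) A⊆B ∣B∣≤∣A∣ =
    ⊥-elim (<-irrefl refl (<-≤-trans (s≤s (card-mono A B A⊆B)) ∣B∣≤∣A∣))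
  card-equal (true ∷ A) (true ∷ B) A⊆B (s≤s ∣B∣≤∣A∣) = cong (true ∷_) (card-equal A B A⊆B ∣B∣≤∣A∣)

  card-─ : (U R : Subset v) → R ⊆ᵇ U ≡ true → ∣ U ─ R ∣ + ∣ R ∣ ≡ ∣ U ∣
  card-─ [] [] _ = refl
  card-─ (false ∷ U) (false ∷ R) R⊆U = card-─ U R R⊆U
  card-─ (true ∷ U) (false ∷ R) R⊆U = cong suc (card-─ U R R⊆U)
  card-─ (true ∷ U) (true ∷ R) R⊆U = trans (+-suc _ _) (cong suc (card-─ U R R⊆U))

  card-zero : (A : Subset v) → ∣ A ∣ ≡ 0 → A ≡ ⊥
  card-zero [] _ = refl
  card-zero (false ∷ A) ∣A∣≡0 = cong (false ∷_) (card-zero A ∣A∣≡0)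

  card-∪ : (A B : Subset v) → ∣ A ∪ B ∣ ≤ ∣ A ∣ + ∣ B ∣
  card-∪ [] [] = z≤n
  card-∪ (true ∷ A) (true ∷ B) = s≤s (≤-trans (card-∪ A B) (m≤n⇒m≤o+n 0 (+-monoʳ-≤ ∣ A ∣ (n≤1+n _))))
  card-∪ (true ∷ A) (false ∷ B) = s≤s (card-∪ A B)
  card-∪ (false ∷ A) (true ∷ B) = ≤-trans (s≤s (card-∪ A B)) (≤-reflexive (sym (+-suc ∣ A ∣ ∣ B ∣)))
  card-∪ (false ∷ A) (false ∷ B) = card-∪ A B

  extend : (X : Subset v) (n : ℕ) → ∣ X ∣ ≤ n → n ≤ v → Σ (Subset v) λ U → X ⊆ᵇ U ≡ true × ∣ U ∣ ≡ n
  extend [] zero _ _ = [] , refl , refl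
  extend (true ∷ X) (suc n) (s≤s ∣X∣≤n) (s≤s n≤v) with extend X n ∣X∣≤n n≤v
  ... | U , X⊆U , ∣U∣≡n = true ∷ U , X⊆U , cong suc ∣U∣≡n
  extend (false ∷ X) zero ∣X∣≤n _ with extend X zero ∣X∣≤n z≤n
  ... | U , X⊆U , ∣U∣≡n = false ∷ U , X⊆U , ∣U∣≡n
  extend (false ∷ X) (suc n) ∣X∣≤n (s≤s n≤v) with ∣ X ∣ ≤? n
  ... | yes ∣X∣≤n' with extend X n ∣X∣≤n' n≤v
  ...   | U , X⊆U , ∣U∣≡n = true ∷ U , X⊆U , cong suc ∣U∣≡n
  extend (false ∷ X) (suc n) ∣X∣≤n (s≤s n≤v) | no ∣X∣≰n
    with extend X (suc n) ∣X∣≤n (≤-trans (≰⇒> ∣X∣≰n) (∣p∣≤n X))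
  ...   | U , X⊆U , ∣U∣≡n = false ∷ U , X⊆U , ∣U∣≡n

  insert : Fin v → Subset v → Subset v
  insert x A = A [ x ]≔ inside

  lookup-⊥ : (x : Fin v) → lookup ⊥ x ≡ false
  lookup-⊥ x = lookup-replicate x outside

  lookup-insert : (x : Fin v) (A : Subset v) → lookup (insert x A) x ≡ true
  lookup-insert x A = lookup∘update x A inside

  lookup-insert-other : {x y : Fin v} (A : Subset v) → x ≢ y → lookup (insert y A) x ≡ lookup A x
  lookup-insert-other A x≢y = lookup∘update′ x≢y A inside

  insert-present : (x : Fin v) (A : Subset v) → lookup A x ≡ true → insert x A ≡ A
  insert-present x A x∈A = trans (cong (A [ x ]≔_) (sym x∈A)) ([]≔-lookup A x)

  card-insert : (x : Fin v) (A : Subset v) → lookup A x ≡ false → ∣ insert x A ∣ ≡ suc ∣ A ∣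
  card-insert zero (false ∷ A) _ = refl
  card-insert (suc x) (false ∷ A) x∉A = card-insert x A x∉A
  card-insert (suc x) (true ∷ A) x∉A = cong suc (card-insert x A x∉A)

  remove : (A : Subset v) (n : ℕ) → ∣ A ∣ ≡ suc n →
    Σ (Fin v) λ x → Σ (Subset v) λ A' → A ≡ insert x A' × lookup A' x ≡ false × ∣ A' ∣ ≡ n
  remove (true ∷ A) n ∣A∣≡1+n = zero , false ∷ A , refl , refl , suc-injective ∣A∣≡1+n
  remove (false ∷ A) n ∣A∣≡1+n with remove A n ∣A∣≡1+n
  ... | x , A' , refl , x∉A' , ∣A'∣≡n = suc x , false ∷ A' , refl , x∉A' , ∣A'∣≡n

  insert-⊆ᵇ : (x : Fin v) (A U : Subset v) → insert x A ⊆ᵇ U ≡ (A ⊆ᵇ U) ∧ lookup U x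
  insert-⊆ᵇ zero (a ∷ A) (false ∷ U) = sym (∧-zeroʳ _)
  insert-⊆ᵇ zero (false ∷ A) (true ∷ U) = sym (∧-identityʳ _)
  insert-⊆ᵇ zero (true ∷ A) (true ∷ U) = sym (∧-identityʳ _)
  insert-⊆ᵇ (suc x) (a ∷ A) (u ∷ U) =
    trans (cong ((not a ∨ u) ∧_) (insert-⊆ᵇ x A U)) (sym (∧-assoc (not a ∨ u) _ _))

  insert-⊆ᵇ⁻ : (x : Fin v) (A U : Subset v) → insert x A ⊆ᵇ U ≡ true → A ⊆ᵇ U ≡ true × lookup U x ≡ true
  insert-⊆ᵇ⁻ x A U A+x⊆U with A ⊆ᵇ U | insert-⊆ᵇ x A U
  ... | true | A+x⊆U≡x∈U = refl , trans (sym A+x⊆U≡x∈U) A+x⊆U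
  ... | false | A+x⊆U≡false with trans (sym A+x⊆U) A+x⊆U≡false
  ...   | ()

  insert-⊆ᵇ⁺ : (x : Fin v) (A U : Subset v) → A ⊆ᵇ U ≡ true → lookup U x ≡ true → insert x A ⊆ᵇ U ≡ true
  insert-⊆ᵇ⁺ x A U A⊆U x∈U rewrite insert-⊆ᵇ x A U | A⊆U | x∈U = refl

  ⊆ᵇ-─-insert : (x : Fin v) (T U B : Subset v) → T ⊆ᵇ U ─ insert x B ≡ (T ⊆ᵇ U ─ B) ∧ not (lookup T x)
  ⊆ᵇ-─-insert zero (false ∷ T) (u ∷ U) (b ∷ B) = sym (∧-identityʳ _)
  ⊆ᵇ-─-insert zero (true ∷ T) (u ∷ U) (b ∷ B) = sym (∧-zeroʳ _)
  ⊆ᵇ-─-insert (suc x) (t ∷ T) (u ∷ U) (false ∷ B) =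
    trans (cong ((not t ∨ u) ∧_) (⊆ᵇ-─-insert x T U B)) (sym (∧-assoc (not t ∨ u) _ _))
  ⊆ᵇ-─-insert (suc x) (false ∷ T) (u ∷ U) (true ∷ B) = ⊆ᵇ-─-insert x T U B
  ⊆ᵇ-─-insert (suc x) (true ∷ T) (u ∷ U) (true ∷ B) = refl

  lookup-insert⁺ : (x y : Fin v) (A : Subset v) → lookup A x ≡ true → lookup (insert y A) x ≡ true
  lookup-insert⁺ x y A x∈A with x ≟ y
  ... | yes refl = lookup-insert x A
  ... | no x≢y = trans (lookup-insert-other A x≢y) x∈A

  lookup-insert⁻ : (x y : Fin v) (A : Subset v) → lookup (insert y A) x ≡ true → x ≡ y ⊎ lookup A x ≡ true
  lookup-insert⁻ x y A x∈A+y with x ≟ y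
  ... | yes x≡y = inj₁ x≡y
  ... | no x≢y = inj₂ (trans (sym (lookup-insert-other A x≢y)) x∈A+y)

module IntervalCounting where

  open import Data.Nat as ℕ using (ℕ; zero; suc; _≡ᵇ_)
  open import Data.Nat.Properties using (≡ᵇ⇒≡; suc-injective; +-suc; <-irrefl; ≤-trans; ≤-reflexive)
  import Data.Nat.Properties as ℕₚ
  open import Data.Nat.Combinatorics using (_C_; nCk+nC[k+1]≡[n+1]C[k+1])
  open import Data.Bool using (true; false; _∧_; T)
  open import Data.Bool.Properties using (∧-zeroʳ; ∧-identityʳ)
  open import Data.Vec using ([]; _∷_)
  open import Data.Fin.Subset using (Subset; ∣_∣; _─_)
  open import Data.Integer using (ℤ; +_; _+_; _*_)
  open import Data.Integer.Properties using (*-zeroˡ; *-zeroʳ; +-identityˡ; +-identityʳ; pos-+)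
  open import Data.Empty using (⊥-elim)
  open import Relation.Binary.PropositionalEquality
  open SubsetSums
  open BitSubsets

  private variable v : ℕ

  disjoint-inside : (R T U : Subset v) → (R ⊆ᵇ U) ∧ (T ⊆ᵇ U ─ R) ≡ (R ⊆ᵇ U ─ T) ∧ (T ⊆ᵇ U)
  disjoint-inside [] [] [] = refl
  disjoint-inside (false ∷ R) (false ∷ T) (u ∷ U) = disjoint-inside R T U
  disjoint-inside (false ∷ R) (true ∷ T) (false ∷ U) = trans (∧-zeroʳ _) (sym (∧-zeroʳ _))
  disjoint-inside (false ∷ R) (true ∷ T) (true ∷ U) = disjoint-inside R T U
  disjoint-inside (true ∷ R) (false ∷ T) (false ∷ U) = refl
  disjoint-inside (true ∷ R) (false ∷ T) (true ∷ U) = disjoint-inside R T U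
  disjoint-inside (true ∷ R) (true ∷ T) (false ∷ U) = refl
  disjoint-inside (true ∷ R) (true ∷ T) (true ∷ U) = ∧-zeroʳ _

  disjoint-inside-⟦⟧ : ∀ {v} (R T U : Subset v) →
    ⟦ R ⊆ᵇ U ⟧ * ⟦ T ⊆ᵇ U ─ R ⟧ ≡ ⟦ R ⊆ᵇ U ─ T ⟧ * ⟦ T ⊆ᵇ U ⟧
  disjoint-inside-⟦⟧ R T U =
    trans (sym (⟦⟧-∧ (R ⊆ᵇ U) _)) (trans (cong ⟦_⟧ (disjoint-inside R T U)) (⟦⟧-∧ (R ⊆ᵇ U ─ T) _))

  disjoint-swap : ∀ {v} (B T U : Subset v) → B ⊆ᵇ U ≡ true → T ⊆ᵇ U ≡ true → T ⊆ᵇ U ─ B ≡ B ⊆ᵇ U ─ T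
  disjoint-swap B T U B⊆U T⊆U = begin
    T ⊆ᵇ U ─ B                  ≡⟨ cong (_∧ (T ⊆ᵇ U ─ B)) (sym B⊆U) ⟩
    (B ⊆ᵇ U) ∧ (T ⊆ᵇ U ─ B)     ≡⟨ disjoint-inside B T U ⟩
    (B ⊆ᵇ U ─ T) ∧ (T ⊆ᵇ U)     ≡⟨ cong ((B ⊆ᵇ U ─ T) ∧_) T⊆U ⟩
    (B ⊆ᵇ U ─ T) ∧ true         ≡⟨ ∧-identityʳ _ ⟩
    B ⊆ᵇ U ─ T                  ∎
    where open ≡-Reasoning

  between : Subset v → Subset v → ℕ → ℤ
  between B Y n = ∑[ R ] (⟦ B ⊆ᵇ R ⟧ * ⟦ R ⊆ᵇ Y ⟧ * ⟦ ∣ R ∣ ≡ᵇ n ⟧)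

  private
    0*x*y≡0 : ∀ x y → + 0 * x * y ≡ + 0
    0*x*y≡0 x y = trans (cong (_* y) (*-zeroˡ x)) (*-zeroˡ y)

    x*0*y≡0 : ∀ x y → x * + 0 * y ≡ + 0
    x*0*y≡0 x y = trans (cong (_* y) (*-zeroʳ x)) (*-zeroˡ y)

    x*y*0≡0 : ∀ x y → x * y * + 0 ≡ + 0
    x*y*0≡0 x y = *-zeroʳ (x * y)

  between-empty : (B Y : Subset v) (n : ℕ) → B ⊆ᵇ Y ≡ false → between B Y n ≡ + 0
  between-empty B Y n B⊈Y = ∑-zero _ term
    where
    term : ∀ R → ⟦ B ⊆ᵇ R ⟧ * ⟦ R ⊆ᵇ Y ⟧ * ⟦ ∣ R ∣ ≡ᵇ n ⟧ ≡ + 0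
    term R with B ⊆ᵇ R in B⊆R | R ⊆ᵇ Y in R⊆Y
    ... | false | _ = 0*x*y≡0 ⟦ R ⊆ᵇ Y ⟧ ⟦ ∣ R ∣ ≡ᵇ n ⟧
    ... | true | false = cong (_* ⟦ ∣ R ∣ ≡ᵇ n ⟧) (*-zeroʳ (+ 1))
    ... | true | true with trans (sym (⊆ᵇ-trans B R Y B⊆R R⊆Y)) B⊈Y
    ...   | ()

  -- By recursion on the coordinates: a coordinate of R is forced unless it lies in Y ∖ B,
  -- where both choices contribute (Pascal's rule).
  between-count : (B Y : Subset v) (d j : ℕ) → B ⊆ᵇ Y ≡ true → ∣ Y ∣ ≡ ∣ B ∣ ℕ.+ d →
    between B Y (∣ B ∣ ℕ.+ j) ≡ + (d C j)
  between-count [] [] d zero _ _ = refl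
  between-count [] [] d (suc j) _ refl = refl
  between-count (true ∷ B) (true ∷ Y) d j B⊆Y ∣Y∣≡∣B∣+d =
    trans (cong₂ _+_ (between-count B Y d j B⊆Y (suc-injective ∣Y∣≡∣B∣+d))
                     (∑-zero _ (λ R → 0*x*y≡0 ⟦ R ⊆ᵇ Y ⟧ ⟦ suc ∣ R ∣ ≡ᵇ suc (∣ B ∣ ℕ.+ j) ⟧)))
          (+-identityʳ _)
  between-count (false ∷ B) (false ∷ Y) d j B⊆Y ∣Y∣≡∣B∣+d =
    trans (cong₂ _+_ (∑-zero _ (λ R → x*0*y≡0 ⟦ B ⊆ᵇ R ⟧ ⟦ suc ∣ R ∣ ≡ᵇ ∣ B ∣ ℕ.+ j ⟧))
                     (between-count B Y d j B⊆Y ∣Y∣≡∣B∣+d))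
          (+-identityˡ _)
  between-count (false ∷ B) (true ∷ Y) zero j B⊆Y ∣Y∣≡∣B∣+0 =
    ⊥-elim (<-irrefl refl (≤-trans (≤-reflexive (trans ∣Y∣≡∣B∣+0 (ℕₚ.+-identityʳ _))) (card-mono B Y B⊆Y)))
  between-count (false ∷ B) (true ∷ Y) (suc d) zero B⊆Y ∣Y∣≡∣B∣+1+d =
    trans (cong₂ _+_ (∑-zero _ term) (between-count B Y d zero B⊆Y ∣Y∣≡∣B∣+d)) (+-identityˡ _)
    where
    ∣Y∣≡∣B∣+d : ∣ Y ∣ ≡ ∣ B ∣ ℕ.+ d
    ∣Y∣≡∣B∣+d = suc-injective (trans ∣Y∣≡∣B∣+1+d (+-suc _ _))
    -- a set containing B has more than |B| - 1 elements
    term : ∀ R → ⟦ B ⊆ᵇ R ⟧ * ⟦ R ⊆ᵇ Y ⟧ * ⟦ suc ∣ R ∣ ≡ᵇ ∣ B ∣ ℕ.+ 0 ⟧ ≡ + 0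
    term R with B ⊆ᵇ R in B⊆R | suc ∣ R ∣ ≡ᵇ ∣ B ∣ ℕ.+ 0 in sizes
    ... | false | b = 0*x*y≡0 ⟦ R ⊆ᵇ Y ⟧ ⟦ b ⟧
    ... | true | false = x*y*0≡0 (+ 1) ⟦ R ⊆ᵇ Y ⟧
    ... | true | true = ⊥-elim (<-irrefl refl (≤-trans (≤-reflexive
            (trans (≡ᵇ⇒≡ _ _ (subst T (sym sizes) _)) (ℕₚ.+-identityʳ _))) (card-mono B R B⊆R)))
  between-count (false ∷ B) (true ∷ Y) (suc d) (suc j) B⊆Y ∣Y∣≡∣B∣+1+d = begin
    between (false ∷ B) (true ∷ Y) (∣ B ∣ ℕ.+ suc j)
      ≡⟨ cong (_+ between B Y (∣ B ∣ ℕ.+ suc j)) (∑-cong shift) ⟩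
    between B Y (∣ B ∣ ℕ.+ j) + between B Y (∣ B ∣ ℕ.+ suc j)
      ≡⟨ cong₂ _+_ (between-count B Y d j B⊆Y ∣Y∣≡∣B∣+d) (between-count B Y d (suc j) B⊆Y ∣Y∣≡∣B∣+d) ⟩
    + (d C j) + + (d C suc j)
      ≡⟨ sym (pos-+ (d C j) (d C suc j)) ⟩
    + (d C j ℕ.+ d C suc j)
      ≡⟨ cong +_ (nCk+nC[k+1]≡[n+1]C[k+1] d j) ⟩
    + (suc d C suc j) ∎
    where
    open ≡-Reasoning
    ∣Y∣≡∣B∣+d : ∣ Y ∣ ≡ ∣ B ∣ ℕ.+ d
    ∣Y∣≡∣B∣+d = suc-injective (trans ∣Y∣≡∣B∣+1+d (+-suc _ _))
    -- sets R ∪ {0} of size |B| + 1 + j correspond to sets R of size |B| + j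
    shift : ∀ R → ⟦ B ⊆ᵇ R ⟧ * ⟦ R ⊆ᵇ Y ⟧ * ⟦ suc ∣ R ∣ ≡ᵇ ∣ B ∣ ℕ.+ suc j ⟧
                ≡ ⟦ B ⊆ᵇ R ⟧ * ⟦ R ⊆ᵇ Y ⟧ * ⟦ ∣ R ∣ ≡ᵇ ∣ B ∣ ℕ.+ j ⟧
    shift R rewrite +-suc ∣ B ∣ j = refl

-- Which primes divide the binomial coefficients C(k-b, 4-b) that the argument must cancel.
module Binomials where

  open import Data.Nat using (ℕ; zero; suc; _+_; _*_; _<_; _≤_; s≤s; z≤n)
  open import Data.Nat.Properties
    using (*-identityˡ; *-zeroʳ; *-distribˡ-+; +-assoc; +-comm; *-assoc; *-cancelˡ-≡; m*n≡0⇒m≡0∨n≡0; <⇒≱;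
           +-cancelˡ-≡; ≤-trans)
  open import Data.Nat.Combinatorics using (_C_; nCk+nC[k+1]≡[n+1]C[k+1])
  open import Data.Nat.Divisibility using (_∣_; divides; ∣⇒≤; ∣1⇒≡1; 0∣⇒≡0; ∣n⇒∣m*n; ∣m+n∣m⇒∣n; n∣m*n; ∣-refl)
  open import Data.Nat.Primality using (Prime; euclidsLemma; prime[2]; prime?)
  open import Relation.Nullary.Decidable using (from-yes)
  open import Data.Nat.Tactic.RingSolver using (solve-∀)
  open import Data.Sum using (_⊎_; inj₁; inj₂)
  open import Data.Product using (Σ; _×_; _,_; proj₁)
  open import Relation.Nullary using (¬_)
  open import Relation.Binary.PropositionalEquality

  private variable p : ℕ

  -- Euclid's property: p divides a product only if it divides a factor.
  -- Primes have it, and so does 0 (divisibility by 0 is equality with 0).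
  Euclidean : ℕ → Set
  Euclidean p = ∀ a b → p ∣ a * b → p ∣ a ⊎ p ∣ b

  prime⇒euclidean : Prime p → Euclidean p
  prime⇒euclidean pp a b = euclidsLemma a b pp

  zero-euclidean : Euclidean 0
  zero-euclidean a b 0∣ab with m*n≡0⇒m≡0∨n≡0 a (0∣⇒≡0 0∣ab)
  ... | inj₁ refl = inj₁ ∣-refl
  ... | inj₂ refl = inj₂ ∣-refl

  absorption : ∀ n j → suc j * (suc n C suc j) ≡ suc n * (n C j)
  absorption zero zero = refl
  absorption zero (suc j) = *-zeroʳ (suc (suc j))
  absorption (suc n) zero = begin
    1 * (suc (suc n) C 1)            ≡⟨ *-identityˡ _ ⟩
    suc (suc n) C 1                   ≡⟨ sym (nCk+nC[k+1]≡[n+1]C[k+1] (suc n) 0) ⟩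
    1 + suc n C 1                     ≡⟨ cong suc (trans (sym (*-identityˡ _)) (absorption n zero)) ⟩
    suc (suc n) * 1                   ∎
    where open ≡-Reasoning
  absorption (suc n) (suc j) = begin
    suc (suc j) * (suc (suc n) C suc (suc j))
      ≡⟨ cong (suc (suc j) *_) (sym (nCk+nC[k+1]≡[n+1]C[k+1] (suc n) (suc j))) ⟩
    suc (suc j) * (A + B)
      ≡⟨ *-distribˡ-+ (suc (suc j)) A B ⟩
    (A + suc j * A) + suc (suc j) * B
      ≡⟨ cong₂ (λ x y → (A + x) + y) (absorption n j) (absorption n (suc j)) ⟩
    (A + suc n * (n C j)) + suc n * (n C suc j)
      ≡⟨ +-assoc A _ _ ⟩
    A + (suc n * (n C j) + suc n * (n C suc j))
      ≡⟨ cong (A +_) (sym (*-distribˡ-+ (suc n) (n C j) (n C suc j))) ⟩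
    A + suc n * (n C j + n C suc j)
      ≡⟨ cong (λ x → A + suc n * x) (nCk+nC[k+1]≡[n+1]C[k+1] n j) ⟩
    suc (suc n) * A ∎
    where
    open ≡-Reasoning
    A B : ℕ
    A = suc n C suc j
    B = suc n C suc (suc j)

  C-quotient : ∀ n j q → suc j * q ≡ suc n → suc n C suc j ≡ q * (n C j)
  C-quotient n j q [j+1]q≡n+1 = *-cancelˡ-≡ _ _ (suc j) (begin
    suc j * (suc n C suc j)  ≡⟨ absorption n j ⟩
    suc n * (n C j)          ≡⟨ cong (_* (n C j)) (sym [j+1]q≡n+1) ⟩
    suc j * q * (n C j)      ≡⟨ *-assoc (suc j) q (n C j) ⟩
    suc j * (q * (n C j))    ∎)
    where open ≡-Reasoning

  euclidean-∤* : Euclidean p → ∀ {a b} → ¬ p ∣ a → ¬ p ∣ b → ¬ p ∣ a * b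
  euclidean-∤* euclid {a} {b} p∤a p∤b p∣ab with euclid a b p∣ab
  ... | inj₁ p∣a = p∤a p∣a
  ... | inj₂ p∣b = p∤b p∣b

  ∤C-step : Euclidean p → ∀ n j → ¬ p ∣ suc n → ¬ p ∣ n C j → ¬ p ∣ suc n C suc j
  ∤C-step {p} euclid n j p∤n+1 p∤C p∣C' =
    euclidean-∤* euclid p∤n+1 p∤C (subst (p ∣_) (absorption n j) (∣n⇒∣m*n (suc j) p∣C'))

  ∤-remainder : ∀ {d r} y → 0 < r → r < d → ¬ d ∣ r + y * d
  ∤-remainder {d} {r@(suc _)} y 0<r r<d d∣r+yd =
    <⇒≱ r<d (∣⇒≤ (∣m+n∣m⇒∣n (subst (d ∣_) (+-comm r (y * d)) d∣r+yd) (n∣m*n y)))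

  -- p avoids k = 4 + r: p divides none of C(k-1, 3), C(k-2, 2), C(k-3, 1).
  -- These are the coefficients the reconstruction argument must cancel.
  Avoids : ℕ → ℕ → Set
  Avoids p r = ¬ p ∣ (3 + r) C 3 × ¬ p ∣ (2 + r) C 2 × ¬ p ∣ (1 + r) C 1

  avoids-by-factors : ∀ r → Euclidean p → ¬ p ∣ 1 → ¬ p ∣ 1 + r → ¬ p ∣ 2 + r → ¬ p ∣ 3 + r → Avoids p r
  avoids-by-factors {p} r euclid p∤1 p∤1+r p∤2+r p∤3+r = p∤C₃ , p∤C₂ , p∤C₁
    where
    p∤C₁ : ¬ p ∣ (1 + r) C 1
    p∤C₁ = ∤C-step euclid r 0 p∤1+r p∤1
    p∤C₂ : ¬ p ∣ (2 + r) C 2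
    p∤C₂ = ∤C-step euclid (1 + r) 1 p∤2+r p∤C₁
    p∤C₃ : ¬ p ∣ (3 + r) C 3
    p∤C₃ = ∤C-step euclid (2 + r) 2 p∤3+r p∤C₂

  private
    ∤1+ : ∀ {d} y → 1 < d → ¬ d ∣ 1 + y * d
    ∤1+ y 1<d = ∤-remainder y (s≤s z≤n) 1<d

    euclidean-2 : Euclidean 2
    euclidean-2 = prime⇒euclidean prime[2]

    euclidean-3 : Euclidean 3
    euclidean-3 = prime⇒euclidean (from-yes (prime? 3))

    2∤1 : ¬ 2 ∣ 1
    2∤1 = ∤1+ {2} 0 (s≤s (s≤s z≤n))

    3∤1 : ¬ 3 ∣ 1
    3∤1 = ∤1+ {3} 0 (s≤s (s≤s z≤n))

  avoids-two : ∀ t → Avoids 2 (t * 4)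
  avoids-two t = 2∤C₃ , 2∤C₂ , 2∤C₁
    where
    odd : ∀ {m} y → m ≡ 1 + y * 2 → ¬ 2 ∣ m
    odd y refl = ∤1+ y (s≤s (s≤s z≤n))
    1+4t-odd : ∀ t → 1 + t * 4 ≡ 1 + (t * 2) * 2
    1+4t-odd = solve-∀
    2[1+2t]≡2+4t : ∀ t → 2 * (1 + t * 2) ≡ 2 + t * 4
    2[1+2t]≡2+4t = solve-∀
    3+4t-odd : ∀ t → 3 + t * 4 ≡ 1 + (1 + t * 2) * 2
    3+4t-odd = solve-∀
    2∤C₁ : ¬ 2 ∣ (1 + t * 4) C 1
    2∤C₁ = ∤C-step euclidean-2 (t * 4) 0 (odd (t * 2) (1+4t-odd t)) 2∤1
    -- C(2 + 4t, 2) = (1 + 2t)(1 + 4t) is a product of odd numbers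
    2∤C₂ : ¬ 2 ∣ (2 + t * 4) C 2
    2∤C₂ 2∣C₂ = euclidean-∤* euclidean-2 (odd t refl) 2∤C₁
      (subst (2 ∣_) (C-quotient (1 + t * 4) 1 (1 + t * 2) (2[1+2t]≡2+4t t)) 2∣C₂)
    2∤C₃ : ¬ 2 ∣ (3 + t * 4) C 3
    2∤C₃ = ∤C-step euclidean-2 (2 + t * 4) 2 (odd (1 + t * 2) (3+4t-odd t)) 2∤C₂

  -- C(k, 4) is odd when k = 4 + 4t with t even, i.e. 4 ∣ k and 8 ∤ k.
  two-∤C₄ : ∀ t → ¬ 2 ∣ 1 + t → ¬ 2 ∣ (4 + t * 4) C 4
  two-∤C₄ t 2∤1+t 2∣C₄ = euclidean-∤* euclidean-2 2∤1+t (proj₁ (avoids-two t))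
    (subst (2 ∣_) (C-quotient (3 + t * 4) 3 (1 + t) (4[1+t]≡4+4t t)) 2∣C₄)
    where
    4[1+t]≡4+4t : ∀ t → 4 * (1 + t) ≡ 4 + t * 4
    4[1+t]≡4+4t = solve-∀

  -- 3 avoids k = 4 + 3s whenever 9 ∤ k - 1 = 3(1 + s).
  avoids-three : ∀ s → ¬ 3 ∣ 1 + s → Avoids 3 (s * 3)
  avoids-three s 3∤1+s = 3∤C₃ , 3∤C₂ , 3∤C₁
    where
    3[1+s]≡3+3s : ∀ s → 3 * (1 + s) ≡ 3 + s * 3
    3[1+s]≡3+3s = solve-∀
    3∤C₁ : ¬ 3 ∣ (1 + s * 3) C 1
    3∤C₁ = ∤C-step euclidean-3 (s * 3) 0 (∤1+ s (s≤s (s≤s z≤n))) 3∤1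
    3∤C₂ : ¬ 3 ∣ (2 + s * 3) C 2
    3∤C₂ = ∤C-step euclidean-3 (1 + s * 3) 1 (∤-remainder s (s≤s z≤n) (s≤s (s≤s (s≤s z≤n)))) 3∤C₁
    -- C(3 + 3s, 3) = (1 + s)·C(2 + 3s, 2)
    3∤C₃ : ¬ 3 ∣ (3 + s * 3) C 3
    3∤C₃ 3∣C₃ = euclidean-∤* euclidean-3 3∤1+s 3∤C₂
      (subst (3 ∣_) (C-quotient (2 + s * 3) 2 (1 + s) (3[1+s]≡3+3s s)) 3∣C₃)

  0∤suc : ∀ {n} → ¬ 0 ∣ suc n
  0∤suc 0∣1+n with 0∣⇒≡0 0∣1+n
  ... | ()

  prime∤1 : ∀ {p} → Prime p → ¬ p ∣ 1
  prime∤1 {suc (suc _)} _ p∣1 with ∣1⇒≡1 p∣1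
  ... | ()

  ≥3∤2 : ∀ {p} → 3 ≤ p → ¬ p ∣ 2
  ≥3∤2 3≤p p∣2 with ≤-trans 3≤p (∣⇒≤ p∣2)
  ... | s≤s (s≤s ())

  -- The shapes of k = 4 + r in the cases p = 2 and p = 3: 4 ∣ k means r = 4t, and then
  -- 8 ∤ k means 2 ∤ 1 + t; 3 ∣ k - 1 means r = 3s, and then 9 ∤ k - 1 means 3 ∤ 1 + s.
  multiple-of-4 : ∀ r → 4 ∣ 4 + r → Σ ℕ λ t → r ≡ t * 4
  multiple-of-4 r (divides (suc t) 4+r≡4+4t) = t , +-cancelˡ-≡ 4 r (t * 4) 4+r≡4+4t

  8∤⇒2∤ : ∀ t → ¬ 8 ∣ 4 + t * 4 → ¬ 2 ∣ 1 + t
  8∤⇒2∤ t 8∤4+4t (divides u 1+t≡2u) =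
    8∤4+4t (divides u (trans (4+4t≡[1+t]4 t) (trans (cong (_* 4) 1+t≡2u) ([2u]4≡8u u))))
    where
    4+4t≡[1+t]4 : ∀ t → 4 + t * 4 ≡ (1 + t) * 4
    4+4t≡[1+t]4 = solve-∀
    [2u]4≡8u : ∀ u → u * 2 * 4 ≡ u * 8
    [2u]4≡8u = solve-∀

  multiple-of-3 : ∀ r → 3 ∣ 3 + r → Σ ℕ λ s → r ≡ s * 3
  multiple-of-3 r 3∣3+r with ∣m+n∣m⇒∣n 3∣3+r ∣-refl
  ... | divides s r≡3s = s , r≡3s

  9∤⇒3∤ : ∀ s → ¬ 9 ∣ 3 + s * 3 → ¬ 3 ∣ 1 + s
  9∤⇒3∤ s 9∤3+3s (divides u 1+s≡3u) =
    9∤3+3s (divides u (trans (3+3s≡[1+s]3 s) (trans (cong (_* 3) 1+s≡3u) ([3u]3≡9u u))))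
    where
    3+3s≡[1+s]3 : ∀ s → 3 + s * 3 ≡ (1 + s) * 3
    3+3s≡[1+s]3 = solve-∀
    [3u]3≡9u : ∀ u → u * 3 * 3 ≡ u * 9
    [3u]3≡9u = solve-∀

module Reconstruction where

  open import Data.Nat as ℕ using (ℕ; zero; suc; z≤n; s≤s; _≤_; _≡ᵇ_; _∸_)
  import Data.Nat.Properties as ℕₚ
  open import Data.Nat.Properties using (≡ᵇ⇒≡)
  open import Data.Nat.Combinatorics using (_C_)
  open import Data.Bool using (true; false; T)
  open import Data.Bool.Properties using (∧-identityʳ; ∧-zeroʳ)
  open import Data.Vec using (lookup)
  open import Data.Fin.Subset using (Subset; ∣_∣; ⊥; _─_; _∪_)
  open import Data.Fin.Subset.Properties using (∣⊥∣≡0; p─⊥≡p; p─q⊆p)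
  open import Data.Integer using (ℤ; +_; _+_; _*_; _-_) renaming (∣_∣ to abs)
  open import Data.Integer.Properties using (*-identityˡ; *-zeroʳ; +-inverseʳ; abs-*)
  open import Data.Integer.Tactic.RingSolver using (solve-∀)
  open import Data.Integer.Divisibility.Signed using (_∣_; divides; ∣m∣n⇒∣m+n; ∣m∣n⇒∣m-n; ∣ᵤ⇒∣; ∣⇒∣ᵤ)
  import Data.Nat.Divisibility as ℕ∣
  open import Relation.Nullary using (¬_)
  open import Data.Product using (_,_; proj₁; proj₂)
  open import Data.Sum using (_⊎_; inj₁; inj₂)
  open import Data.Empty using (⊥-elim)
  open import Relation.Binary.PropositionalEquality
  open SubsetSums
  open BitSubsets
  open IntervalCounting
  open Binomials using (Euclidean; Avoids)

  Cancels : ℤ → ℕ → Set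
  Cancels M c = ∀ x → M ∣ + c * x → M ∣ x

  euclidean-cancels : ∀ {p c} → Euclidean p → ¬ p ℕ∣.∣ c → Cancels (+ p) c
  euclidean-cancels {p} {c} euclid p∤c x p∣cx
    with euclid c (abs x) (subst (p ℕ∣.∣_) (abs-* (+ c) x) (∣⇒∣ᵤ p∣cx))
  ... | inj₁ p∣c = ⊥-elim (p∤c p∣c)
  ... | inj₂ p∣∣x∣ = ∣ᵤ⇒∣ p∣∣x∣

  avoids-cancels : ∀ {p r} → Euclidean p → Avoids p r →
    ∀ b → 1 ≤ b → b ≤ 4 → Cancels (+ p) ((4 ℕ.+ r ∸ b) C (4 ∸ b))
  avoids-cancels euclid (p∤C₃ , _ , _) 1 _ _ = euclidean-cancels euclid p∤C₃
  avoids-cancels euclid (_ , p∤C₂ , _) 2 _ _ = euclidean-cancels euclid p∤C₂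
  avoids-cancels euclid (_ , _ , p∤C₁) 3 _ _ = euclidean-cancels euclid p∤C₁
  avoids-cancels {p} euclid _ 4 _ _ x p∣1x = subst (+ p ∣_) (*-identityˡ x) p∣1x
  avoids-cancels euclid _ (suc (suc (suc (suc (suc _))))) _ (s≤s (s≤s (s≤s (s≤s ()))))

  private
    M∣0 : ∀ M → M ∣ + 0
    M∣0 M = divides (+ 0) refl

    solve-for : ∀ x y z → x ≡ y + z → y ≡ x - z
    solve-for x y z x≡y+z = trans (y≡[y+z]-z y z) (cong (_- z) (sym x≡y+z))
      where y≡[y+z]-z : ∀ y z → y ≡ (y + z) - z
            y≡[y+z]-z = solve-∀

    F≡0-case : ∀ t n x c → + 0 * + 1 * t * n ≡ c * (+ 1 * x * + 0)
    F≡0-case = solve-∀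
    outside-case : ∀ f n c → f * + 1 * + 0 * n ≡ c * (+ 1 * + 0 * f)
    outside-case = solve-∀
    inside-case : ∀ f x c → f * + 1 * + 1 * (x * c) ≡ c * (+ 1 * x * f)
    inside-case = solve-∀

  module _ {v : ℕ} (M : ℤ) (k : ℕ) (F : Subset v → ℤ)
    (F-on-4-sets : ∀ T → F T ≡ + 0 ⊎ ∣ T ∣ ≡ 4)
    (hyp : ∀ K → ∣ K ∣ ≡ k → M ∣ ∑[ T ] (⟦ T ⊆ᵇ K ⟧ * F T))
    (cancels : ∀ b → 1 ≤ b → b ≤ 4 → Cancels M ((k ∸ b) C (4 ∸ b)))
    (4≤k : 4 ≤ k) where

    module InsideU (U : Subset v) (∣U∣≡k+4 : ∣ U ∣ ≡ k ℕ.+ 4) where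

      window : Subset v → Subset v → ℤ
      window A B = ∑[ T ] (⟦ A ⊆ᵇ T ⟧ * ⟦ T ⊆ᵇ U ─ B ⟧ * F T)

      card-complement : ∀ R → R ⊆ᵇ U ≡ true → ∣ R ∣ ≡ 4 → ∣ U ─ R ∣ ≡ k
      card-complement R R⊆U ∣R∣≡4 = ℕₚ.+-cancelʳ-≡ 4 _ _ (begin
        ∣ U ─ R ∣ ℕ.+ 4     ≡⟨ cong (∣ U ─ R ∣ ℕ.+_) (sym ∣R∣≡4) ⟩
        ∣ U ─ R ∣ ℕ.+ ∣ R ∣  ≡⟨ card-─ U R R⊆U ⟩
        ∣ U ∣               ≡⟨ ∣U∣≡k+4 ⟩
        k ℕ.+ 4 ∎)
        where open ≡-Reasoning

      window-4 : ∀ R → R ⊆ᵇ U ≡ true → ∣ R ∣ ≡ 4 → M ∣ window ⊥ R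
      window-4 R R⊆U ∣R∣≡4 = subst (M ∣_) (∑-cong add-⊥) (hyp (U ─ R) (card-complement R R⊆U ∣R∣≡4))
        where
        add-⊥ : ∀ T → ⟦ T ⊆ᵇ U ─ R ⟧ * F T ≡ ⟦ ⊥ ⊆ᵇ T ⟧ * ⟦ T ⊆ᵇ U ─ R ⟧ * F T
        add-⊥ T rewrite ⊥-⊆ᵇ T = cong (_* F T) (sym (*-identityˡ ⟦ T ⊆ᵇ U ─ R ⟧))

      -- multiplicity B = C(k-|B|, 4-|B|): how often the double count below sees each set.
      multiplicity : Subset v → ℕ
      multiplicity B = (k ∸ ∣ B ∣) C (4 ∸ ∣ B ∣)

      between-4 : ∀ B T → ∣ B ∣ ≤ 4 → T ⊆ᵇ U ≡ true → ∣ T ∣ ≡ 4 →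
        between B (U ─ T) 4 ≡ ⟦ B ⊆ᵇ U ─ T ⟧ * + multiplicity B
      between-4 B T ∣B∣≤4 T⊆U ∣T∣≡4 with B ⊆ᵇ U ─ T in B⊆U─T
      ... | false = between-empty B (U ─ T) 4 B⊆U─T
      ... | true = begin
        between B (U ─ T) 4
          ≡⟨ cong (between B (U ─ T)) (sym (ℕₚ.m+[n∸m]≡n ∣B∣≤4)) ⟩
        between B (U ─ T) (∣ B ∣ ℕ.+ (4 ∸ ∣ B ∣))
          ≡⟨ between-count B (U ─ T) (k ∸ ∣ B ∣) (4 ∸ ∣ B ∣) B⊆U─T ∣U─T∣≡∣B∣+[k-∣B∣] ⟩
        + multiplicity B
          ≡⟨ sym (*-identityˡ _) ⟩
        + 1 * + multiplicity B ∎
        where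
        open ≡-Reasoning
        ∣U─T∣≡∣B∣+[k-∣B∣] : ∣ U ─ T ∣ ≡ ∣ B ∣ ℕ.+ (k ∸ ∣ B ∣)
        ∣U─T∣≡∣B∣+[k-∣B∣] =
          trans (card-complement T T⊆U ∣T∣≡4) (sym (ℕₚ.m+[n∸m]≡n (ℕₚ.≤-trans ∣B∣≤4 4≤k)))

      exchange : ∀ B T →
        ∑[ R ] (⟦ B ⊆ᵇ R ⟧ * ⟦ R ⊆ᵇ U ⟧ * ⟦ ∣ R ∣ ≡ᵇ 4 ⟧ * (⟦ ⊥ ⊆ᵇ T ⟧ * ⟦ T ⊆ᵇ U ─ R ⟧ * F T))
          ≡ F T * ⟦ ⊥ ⊆ᵇ T ⟧ * ⟦ T ⊆ᵇ U ⟧ * between B (U ─ T) 4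
      exchange B T = begin
        ∑[ R ] (⟦ B ⊆ᵇ R ⟧ * ⟦ R ⊆ᵇ U ⟧ * ⟦ ∣ R ∣ ≡ᵇ 4 ⟧ * (⟦ ⊥ ⊆ᵇ T ⟧ * ⟦ T ⊆ᵇ U ─ R ⟧ * F T))
          ≡⟨ ∑-cong (λ R → trans
               (rearrange₁ ⟦ B ⊆ᵇ R ⟧ ⟦ R ⊆ᵇ U ⟧ ⟦ ∣ R ∣ ≡ᵇ 4 ⟧ ⟦ ⊥ ⊆ᵇ T ⟧ ⟦ T ⊆ᵇ U ─ R ⟧ (F T))
               (cong (λ x → F T * ⟦ ⊥ ⊆ᵇ T ⟧ * (⟦ B ⊆ᵇ R ⟧ * x * ⟦ ∣ R ∣ ≡ᵇ 4 ⟧)) (disjoint-inside-⟦⟧ R T U))) ⟩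
        ∑[ R ] (F T * ⟦ ⊥ ⊆ᵇ T ⟧ * (⟦ B ⊆ᵇ R ⟧ * (⟦ R ⊆ᵇ U ─ T ⟧ * ⟦ T ⊆ᵇ U ⟧) * ⟦ ∣ R ∣ ≡ᵇ 4 ⟧))
          ≡⟨ ∑-cong (λ R → rearrange₂ ⟦ B ⊆ᵇ R ⟧ ⟦ R ⊆ᵇ U ─ T ⟧ ⟦ ∣ R ∣ ≡ᵇ 4 ⟧ ⟦ ⊥ ⊆ᵇ T ⟧ ⟦ T ⊆ᵇ U ⟧ (F T)) ⟩
        ∑[ R ] (F T * ⟦ ⊥ ⊆ᵇ T ⟧ * ⟦ T ⊆ᵇ U ⟧ * (⟦ B ⊆ᵇ R ⟧ * ⟦ R ⊆ᵇ U ─ T ⟧ * ⟦ ∣ R ∣ ≡ᵇ 4 ⟧))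
          ≡⟨ ∑-*ˡ (F T * ⟦ ⊥ ⊆ᵇ T ⟧ * ⟦ T ⊆ᵇ U ⟧) (λ R → ⟦ B ⊆ᵇ R ⟧ * ⟦ R ⊆ᵇ U ─ T ⟧ * ⟦ ∣ R ∣ ≡ᵇ 4 ⟧) ⟩
        F T * ⟦ ⊥ ⊆ᵇ T ⟧ * ⟦ T ⊆ᵇ U ⟧ * between B (U ─ T) 4 ∎
        where
        open ≡-Reasoning
        rearrange₁ : ∀ b r n z t f → b * r * n * (z * t * f) ≡ f * z * (b * (r * t) * n)
        rearrange₁ = solve-∀
        rearrange₂ : ∀ b r n z t f → f * z * (b * (r * t) * n) ≡ f * z * t * (b * r * n)
        rearrange₂ = solve-∀

      counted : ∀ B → B ⊆ᵇ U ≡ true → ∣ B ∣ ≤ 4 → ∀ T →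
        F T * ⟦ ⊥ ⊆ᵇ T ⟧ * ⟦ T ⊆ᵇ U ⟧ * between B (U ─ T) 4
          ≡ + multiplicity B * (⟦ ⊥ ⊆ᵇ T ⟧ * ⟦ T ⊆ᵇ U ─ B ⟧ * F T)
      counted B B⊆U ∣B∣≤4 T rewrite ⊥-⊆ᵇ T with F-on-4-sets T
      ... | inj₁ F≡0 rewrite F≡0 = F≡0-case ⟦ T ⊆ᵇ U ⟧ (between B (U ─ T) 4) ⟦ T ⊆ᵇ U ─ B ⟧ (+ multiplicity B)
      ... | inj₂ ∣T∣≡4 with T ⊆ᵇ U in T⊆U
      ...   | true rewrite between-4 B T ∣B∣≤4 T⊆U ∣T∣≡4 | disjoint-swap B T U B⊆U T⊆U =
              inside-case (F T) ⟦ B ⊆ᵇ U ─ T ⟧ (+ multiplicity B)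
      ...   | false with T ⊆ᵇ U ─ B in T⊆U─B
      ...     | false = outside-case (F T) (between B (U ─ T) 4) (+ multiplicity B)
      ...     | true with trans (sym (⊆ᵇ-trans T (U ─ B) U T⊆U─B (⊆ᵇ-complete _ _ (p─q⊆p U B)))) T⊆U
      ...       | ()

      -- Double counting: summing window ⊥ R over the 4-sets B ⊆ R ⊆ U counts every
      -- 4-set T ⊆ U ∖ B exactly multiplicity B times.
      averaging : ∀ B → B ⊆ᵇ U ≡ true → ∣ B ∣ ≤ 4 →
        ∑[ R ] (⟦ B ⊆ᵇ R ⟧ * ⟦ R ⊆ᵇ U ⟧ * ⟦ ∣ R ∣ ≡ᵇ 4 ⟧ * window ⊥ R) ≡ + multiplicity B * window ⊥ B
      averaging B B⊆U ∣B∣≤4 = begin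
        ∑[ R ] (ind R * window ⊥ R)
          ≡⟨ ∑-cong (λ R → sym (∑-*ˡ (ind R) (term R))) ⟩
        ∑[ R ] ∑[ T ] (ind R * term R T)
          ≡⟨ ∑-swap (λ R T → ind R * term R T) ⟩
        ∑[ T ] ∑[ R ] (ind R * term R T)
          ≡⟨ ∑-cong (exchange B) ⟩
        ∑[ T ] (F T * ⟦ ⊥ ⊆ᵇ T ⟧ * ⟦ T ⊆ᵇ U ⟧ * between B (U ─ T) 4)
          ≡⟨ ∑-cong (counted B B⊆U ∣B∣≤4) ⟩
        ∑[ T ] (+ multiplicity B * term B T)
          ≡⟨ ∑-*ˡ (+ multiplicity B) (term B) ⟩
        + multiplicity B * window ⊥ B ∎
        where
        open ≡-Reasoning
        ind : Subset v → ℤ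
        ind R = ⟦ B ⊆ᵇ R ⟧ * ⟦ R ⊆ᵇ U ⟧ * ⟦ ∣ R ∣ ≡ᵇ 4 ⟧
        term : Subset v → Subset v → ℤ
        term R T = ⟦ ⊥ ⊆ᵇ T ⟧ * ⟦ T ⊆ᵇ U ─ R ⟧ * F T

      -- M ∣ multiplicity B · window ⊥ B, as each window ⊥ R with |R| = 4 is a multiple of M.
      window-scaled-∣ : ∀ B → B ⊆ᵇ U ≡ true → ∣ B ∣ ≤ 4 → M ∣ + multiplicity B * window ⊥ B
      window-scaled-∣ B B⊆U ∣B∣≤4 = subst (M ∣_) (averaging B B⊆U ∣B∣≤4) (∑-∣ M _ term)
        where
        term : ∀ R → M ∣ ⟦ B ⊆ᵇ R ⟧ * ⟦ R ⊆ᵇ U ⟧ * ⟦ ∣ R ∣ ≡ᵇ 4 ⟧ * window ⊥ R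
        term R with B ⊆ᵇ R | R ⊆ᵇ U in R⊆U | ∣ R ∣ ≡ᵇ 4 in ∣R∣≡ᵇ4
        ... | true | true | true =
          subst (M ∣_) (sym (*-identityˡ _)) (window-4 R R⊆U (≡ᵇ⇒≡ ∣ R ∣ 4 (subst T (sym ∣R∣≡ᵇ4) _)))
        ... | true | true | false = M∣0 M
        ... | true | false | _ = M∣0 M
        ... | false | _ | _ = M∣0 M

      -- Inclusion–exclusion on one element x: a set T ⊇ A either contains x or avoids it.
      window-split : ∀ x A B → window A B ≡ window (insert x A) B + window A (insert x B)
      window-split x A B = trans (∑-cong pointwise)
        (∑-+ (λ T → ⟦ insert x A ⊆ᵇ T ⟧ * ⟦ T ⊆ᵇ U ─ B ⟧ * F T) (λ T → ⟦ A ⊆ᵇ T ⟧ * ⟦ T ⊆ᵇ U ─ insert x B ⟧ * F T))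
        where
        with-x : ∀ a b f → a * b * f ≡ a * b * f + a * + 0 * f
        with-x = solve-∀
        without-x : ∀ a b f → a * b * f ≡ + 0 * b * f + a * b * f
        without-x = solve-∀
        pointwise : ∀ T → ⟦ A ⊆ᵇ T ⟧ * ⟦ T ⊆ᵇ U ─ B ⟧ * F T
          ≡ ⟦ insert x A ⊆ᵇ T ⟧ * ⟦ T ⊆ᵇ U ─ B ⟧ * F T + ⟦ A ⊆ᵇ T ⟧ * ⟦ T ⊆ᵇ U ─ insert x B ⟧ * F T
        pointwise T rewrite insert-⊆ᵇ x A T | ⊆ᵇ-─-insert x T U B with lookup T x
        ... | true rewrite ∧-identityʳ (A ⊆ᵇ T) | ∧-zeroʳ (T ⊆ᵇ U ─ B) =
          with-x ⟦ A ⊆ᵇ T ⟧ ⟦ T ⊆ᵇ U ─ B ⟧ (F T)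
        ... | false rewrite ∧-zeroʳ (A ⊆ᵇ T) | ∧-identityʳ (T ⊆ᵇ U ─ B) =
          without-x ⟦ A ⊆ᵇ T ⟧ ⟦ T ⊆ᵇ U ─ B ⟧ (F T)

      -- Every window of A ⊆ U excluding a nonempty B ⊆ U with |A| + |B| ≤ 4 is a multiple of M.
      -- By induction on |A|: window-split moves an element of A into B.
      window-∣ : ∀ n A → ∣ A ∣ ≡ n → A ⊆ᵇ U ≡ true →
        ∀ B → B ⊆ᵇ U ≡ true → 1 ≤ ∣ B ∣ → n ℕ.+ ∣ B ∣ ≤ 4 → M ∣ window A B
      window-∣ zero A ∣A∣≡0 _ B B⊆U 1≤∣B∣ ∣B∣≤4 rewrite card-zero A ∣A∣≡0 =
        cancels ∣ B ∣ 1≤∣B∣ ∣B∣≤4 (window ⊥ B) (window-scaled-∣ B B⊆U ∣B∣≤4)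
      window-∣ (suc n) A ∣A∣≡1+n A⊆U B B⊆U 1≤∣B∣ 1+n+∣B∣≤4 with remove A n ∣A∣≡1+n
      ... | x , A' , refl , _ , ∣A'∣≡n =
        subst (M ∣_) (sym (solve-for (window A' B) _ _ (window-split x A' B))) (∣m∣n⇒∣m-n M∣A'B M∣A'B+x)
        where
        A'⊆U : A' ⊆ᵇ U ≡ true
        A'⊆U = proj₁ (insert-⊆ᵇ⁻ x A' U A⊆U)
        x∈U : lookup U x ≡ true
        x∈U = proj₂ (insert-⊆ᵇ⁻ x A' U A⊆U)
        M∣A'B : M ∣ window A' B
        M∣A'B = window-∣ n A' ∣A'∣≡n A'⊆U B B⊆U 1≤∣B∣ (ℕₚ.≤-trans (ℕₚ.n≤1+n _) 1+n+∣B∣≤4)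
        M∣A'B+x : M ∣ window A' (insert x B)
        M∣A'B+x with lookup B x in x∈?B
        ... | true rewrite insert-present x B x∈?B = M∣A'B
        ... | false = window-∣ n A' ∣A'∣≡n A'⊆U (insert x B) (insert-⊆ᵇ⁺ x B U B⊆U x∈U)
          (subst (1 ≤_) (sym (card-insert x B x∈?B)) (s≤s z≤n))
          (subst (_≤ 4) (trans (sym (ℕₚ.+-suc n ∣ B ∣)) (cong (n ℕ.+_) (sym (card-insert x B x∈?B)))) 1+n+∣B∣≤4)

      window-≡ : ∀ n A → ∣ A ∣ ≡ n → A ⊆ᵇ U ≡ true → n ≤ 4 → M ∣ window A ⊥ - window ⊥ ⊥
      window-≡ zero A ∣A∣≡0 _ _ rewrite card-zero A ∣A∣≡0 | +-inverseʳ (window ⊥ ⊥) = M∣0 M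
      window-≡ (suc n) A ∣A∣≡1+n A⊆U 1+n≤4 with remove A n ∣A∣≡1+n
      ... | x , A' , refl , _ , ∣A'∣≡n = subst (M ∣_) (sym regroup) (∣m∣n⇒∣m-n IH M∣A'x)
        where
        A'⊆U : A' ⊆ᵇ U ≡ true
        A'⊆U = proj₁ (insert-⊆ᵇ⁻ x A' U A⊆U)
        x∈U : lookup U x ≡ true
        x∈U = proj₂ (insert-⊆ᵇ⁻ x A' U A⊆U)
        IH : M ∣ window A' ⊥ - window ⊥ ⊥
        IH = window-≡ n A' ∣A'∣≡n A'⊆U (ℕₚ.≤-trans (ℕₚ.n≤1+n _) 1+n≤4)
        ∣x∣≡1 : ∣ insert x ⊥ ∣ ≡ 1
        ∣x∣≡1 = trans (card-insert x ⊥ (lookup-⊥ x)) (cong suc (∣⊥∣≡0 v))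
        M∣A'x : M ∣ window A' (insert x ⊥)
        M∣A'x = window-∣ n A' ∣A'∣≡n A'⊆U (insert x ⊥) (insert-⊆ᵇ⁺ x ⊥ U (⊥-⊆ᵇ U) x∈U)
          (ℕₚ.≤-reflexive (sym ∣x∣≡1))
          (subst (_≤ 4) (trans (ℕₚ.+-comm 1 n) (cong (n ℕ.+_) (sym ∣x∣≡1))) 1+n≤4)
        swap-− : ∀ a b c → (a - b) - c ≡ (a - c) - b
        swap-− = solve-∀
        regroup : window (insert x A') ⊥ - window ⊥ ⊥ ≡ (window A' ⊥ - window ⊥ ⊥) - window A' (insert x ⊥)
        regroup = trans
          (cong (_- window ⊥ ⊥) (solve-for (window A' ⊥) (window (insert x A') ⊥) (window A' (insert x ⊥))
                                            (window-split x A' ⊥)))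
          (swap-− (window A' ⊥) (window A' (insert x ⊥)) (window ⊥ ⊥))

      window-single : ∀ T → T ⊆ᵇ U ≡ true → ∣ T ∣ ≡ 4 → window T ⊥ ≡ F T
      window-single T T⊆U ∣T∣≡4 = trans (∑-single T _ vanishes) at-T
        where
        vanishes : ∀ X → X ≢ T → ⟦ T ⊆ᵇ X ⟧ * ⟦ X ⊆ᵇ U ─ ⊥ ⟧ * F X ≡ + 0
        vanishes X X≢T with F-on-4-sets X
        ... | inj₁ F≡0 rewrite F≡0 = *-zeroʳ (⟦ T ⊆ᵇ X ⟧ * ⟦ X ⊆ᵇ U ─ ⊥ ⟧)
        ... | inj₂ ∣X∣≡4 with T ⊆ᵇ X in T⊆X
        ...   | true = ⊥-elim (X≢T (sym (card-equal T X T⊆X (ℕₚ.≤-reflexive (trans ∣X∣≡4 (sym ∣T∣≡4))))))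
        ...   | false = refl
        at-T : ⟦ T ⊆ᵇ T ⟧ * ⟦ T ⊆ᵇ U ─ ⊥ ⟧ * F T ≡ F T
        at-T rewrite ⊆ᵇ-refl T | p─⊥≡p U | T⊆U = *-identityˡ (F T)

      F-≡-window : ∀ T → T ⊆ᵇ U ≡ true → ∣ T ∣ ≡ 4 → M ∣ F T - window ⊥ ⊥
      F-≡-window T T⊆U ∣T∣≡4 =
        subst (λ w → M ∣ w - window ⊥ ⊥) (window-single T T⊆U ∣T∣≡4) (window-≡ 4 T ∣T∣≡4 T⊆U ℕₚ.≤-refl)

      window-∅-scaled : M ∣ + (k C 4) * window ⊥ ⊥
      window-∅-scaled = subst (λ b → M ∣ + ((k ∸ b) C (4 ∸ b)) * window ⊥ ⊥) (∣⊥∣≡0 v)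
        (window-scaled-∣ ⊥ (⊥-⊆ᵇ U) (ℕₚ.≤-trans (ℕₚ.≤-reflexive (∣⊥∣≡0 v)) z≤n))

    private
      8≤k+4 : 8 ≤ k ℕ.+ 4
      8≤k+4 = ℕₚ.+-monoˡ-≤ 4 4≤k

    -- F is constant modulo M on the 4-sets: any two of them lie in a common (k+4)-set U.
    F-constant : k ℕ.+ 4 ≤ v → ∀ T₁ T₂ → ∣ T₁ ∣ ≡ 4 → ∣ T₂ ∣ ≡ 4 → M ∣ F T₁ - F T₂
    F-constant k+4≤v T₁ T₂ ∣T₁∣≡4 ∣T₂∣≡4 with extend (T₁ ∪ T₂) (k ℕ.+ 4) ∣T₁∪T₂∣≤k+4 k+4≤v
      where
      ∣T₁∪T₂∣≤k+4 : ∣ T₁ ∪ T₂ ∣ ≤ k ℕ.+ 4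
      ∣T₁∪T₂∣≤k+4 = ℕₚ.≤-trans (card-∪ T₁ T₂)
        (subst (_≤ k ℕ.+ 4) (cong₂ ℕ._+_ (sym ∣T₁∣≡4) (sym ∣T₂∣≡4)) 8≤k+4)
    ... | U , T₁∪T₂⊆U , ∣U∣≡k+4 =
      subst (M ∣_) (cancel-w (F T₁) (F T₂) (window ⊥ ⊥)) (∣m∣n⇒∣m-n M∣F₁-w M∣F₂-w)
      where
      open InsideU U ∣U∣≡k+4
      cancel-w : ∀ a b w → (a - w) - (b - w) ≡ a - b
      cancel-w = solve-∀
      M∣F₁-w : M ∣ F T₁ - window ⊥ ⊥
      M∣F₁-w = F-≡-window T₁ (⊆ᵇ-trans T₁ (T₁ ∪ T₂) U (⊆ᵇ-∪ˡ T₁ T₂) T₁∪T₂⊆U) ∣T₁∣≡4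
      M∣F₂-w : M ∣ F T₂ - window ⊥ ⊥
      M∣F₂-w = F-≡-window T₂ (⊆ᵇ-trans T₂ (T₁ ∪ T₂) U (⊆ᵇ-∪ʳ T₁ T₂) T₁∪T₂⊆U) ∣T₂∣≡4

    F-vanishes : k ℕ.+ 4 ≤ v → Cancels M (k C 4) → ∀ T → ∣ T ∣ ≡ 4 → M ∣ F T
    F-vanishes k+4≤v cancels-C₄ T ∣T∣≡4 with extend T (k ℕ.+ 4) ∣T∣≤k+4 k+4≤v
      where
      ∣T∣≤k+4 : ∣ T ∣ ≤ k ℕ.+ 4
      ∣T∣≤k+4 = subst (_≤ k ℕ.+ 4) (sym ∣T∣≡4) (ℕₚ.≤-trans (ℕₚ.+-monoʳ-≤ 4 z≤n) 8≤k+4)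
    ... | U , T⊆U , ∣U∣≡k+4 =
      subst (M ∣_) (add-w (F T) (window ⊥ ⊥))
        (∣m∣n⇒∣m+n (F-≡-window T T⊆U ∣T∣≡4) (cancels-C₄ (window ⊥ ⊥) window-∅-scaled))
      where
      open InsideU U ∣U∣≡k+4
      add-w : ∀ a w → (a - w) + w ≡ a
      add-w = solve-∀

module DecomposableSets where

  open import Data.Nat using (zero; suc; s≤s; _≤_; _+_)
  open import Data.Bool using (Bool; true; false)
  open import Data.Vec using (Vec; []; _∷_; lookup; tabulate)
  open import Data.Vec.Properties using ([]=⇒lookup; lookup⇒[]=; lookup∘tabulate)
  open import Data.Fin using (Fin; zero; suc; #_; _↑ˡ_)
  open import Data.Fin.Properties using (_≟_; ↑ˡ-injective; suc-injective)
  open import Data.Fin.Subset using (Subset; ∣_∣; ⊥; _∈_; _∉_)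
  open import Data.Fin.Subset.Properties using (∣⊥∣≡0; x∈⁅y⁆⇒x≡y)
  open import Data.Product using (Σ; _×_; _,_)
  open import Data.Sum using (inj₁; inj₂)
  open import Data.Empty using (⊥-elim)
  open import Function using (_∘_)
  open import Relation.Nullary using (¬_)
  open import Relation.Nullary.Decidable using (False; toWitnessFalse)
  open import Relation.Binary.PropositionalEquality
  open import Defs using (Graph; adj; Indecomposable; IsInterval; IsTrivial)
  open BitSubsets

  ThreeAlike : Vec Bool 5 → Set
  ThreeAlike bs = Σ (Fin 5) λ i → Σ (Fin 5) λ j → Σ (Fin 5) λ l →
    i ≢ j × i ≢ l × j ≢ l × lookup bs i ≡ lookup bs j × lookup bs i ≡ lookup bs l

  private
    -- for concrete positions the distinctness proofs are found by computation
    pick : ∀ bs i j l {i≢j : False (i ≟ j)} {i≢l : False (i ≟ l)} {j≢l : False (j ≟ l)} →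
      lookup bs i ≡ lookup bs j → lookup bs i ≡ lookup bs l → ThreeAlike bs
    pick bs i j l {i≢j} {i≢l} {j≢l} bi≡bj bi≡bl =
      i , j , l , toWitnessFalse i≢j , toWitnessFalse i≢l , toWitnessFalse j≢l , bi≡bj , bi≡bl

  -- Pigeonhole: among five Booleans, three are equal.  If the first three are not all
  -- equal, exactly two of them agree and the last two entries decide.
  three-alike : ∀ bs → ThreeAlike bs
  three-alike bs@(true ∷ true ∷ true ∷ _) = pick bs (# 0) (# 1) (# 2) refl refl
  three-alike bs@(false ∷ false ∷ false ∷ _) = pick bs (# 0) (# 1) (# 2) refl refl
  three-alike bs@(true ∷ true ∷ false ∷ true ∷ _) = pick bs (# 0) (# 1) (# 3) refl refl
  three-alike bs@(true ∷ true ∷ false ∷ false ∷ true ∷ []) = pick bs (# 0) (# 1) (# 4) refl refl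
  three-alike bs@(true ∷ true ∷ false ∷ false ∷ false ∷ []) = pick bs (# 2) (# 3) (# 4) refl refl
  three-alike bs@(false ∷ false ∷ true ∷ false ∷ _) = pick bs (# 0) (# 1) (# 3) refl refl
  three-alike bs@(false ∷ false ∷ true ∷ true ∷ false ∷ []) = pick bs (# 0) (# 1) (# 4) refl refl
  three-alike bs@(false ∷ false ∷ true ∷ true ∷ true ∷ []) = pick bs (# 2) (# 3) (# 4) refl refl
  three-alike bs@(true ∷ false ∷ true ∷ true ∷ _) = pick bs (# 0) (# 2) (# 3) refl refl
  three-alike bs@(true ∷ false ∷ true ∷ false ∷ true ∷ []) = pick bs (# 0) (# 2) (# 4) refl refl
  three-alike bs@(true ∷ false ∷ true ∷ false ∷ false ∷ []) = pick bs (# 1) (# 3) (# 4) refl refl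
  three-alike bs@(false ∷ true ∷ false ∷ false ∷ _) = pick bs (# 0) (# 2) (# 3) refl refl
  three-alike bs@(false ∷ true ∷ false ∷ true ∷ false ∷ []) = pick bs (# 0) (# 2) (# 4) refl refl
  three-alike bs@(false ∷ true ∷ false ∷ true ∷ true ∷ []) = pick bs (# 1) (# 3) (# 4) refl refl
  three-alike bs@(false ∷ true ∷ true ∷ true ∷ _) = pick bs (# 1) (# 2) (# 3) refl refl
  three-alike bs@(false ∷ true ∷ true ∷ false ∷ true ∷ []) = pick bs (# 1) (# 2) (# 4) refl refl
  three-alike bs@(false ∷ true ∷ true ∷ false ∷ false ∷ []) = pick bs (# 0) (# 3) (# 4) refl refl
  three-alike bs@(true ∷ false ∷ false ∷ false ∷ _) = pick bs (# 1) (# 2) (# 3) refl refl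
  three-alike bs@(true ∷ false ∷ false ∷ true ∷ false ∷ []) = pick bs (# 1) (# 2) (# 4) refl refl
  three-alike bs@(true ∷ false ∷ false ∷ true ∷ true ∷ []) = pick bs (# 0) (# 3) (# 4) refl refl

  -- If three distinct vertices a, b, c have the same adjacency to a fourth vertex x,
  -- then {a, b, c} is a nontrivial interval of {x, a, b, c}, which is thus decomposable.
  module _ {v} (G : Graph v) (x a b c : Fin v)
    (x≢a : x ≢ a) (x≢b : x ≢ b) (x≢c : x ≢ c) (a≢b : a ≢ b) (a≢c : a ≢ c) (b≢c : b ≢ c)
    (xa≡xb : adj G x a ≡ adj G x b) (xa≡xc : adj G x a ≡ adj G x c) where

    private
      C : Subset v
      C = insert c ⊥
      BC : Subset v
      BC = insert b C
      I : Subset v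
      I = insert a BC

      Q : Subset v
      Q = insert x I

      ∈⇒lookup : ∀ {y} {X : Subset v} → y ∈ X → lookup X y ≡ true
      ∈⇒lookup = []=⇒lookup

      lookup⇒∈ : ∀ {y} {X : Subset v} → lookup X y ≡ true → y ∈ X
      lookup⇒∈ {y} {X} = lookup⇒[]= y X

      x∉I : lookup I x ≡ false
      x∉I = trans (lookup-insert-other BC x≢a) (trans (lookup-insert-other C x≢b)
              (trans (lookup-insert-other ⊥ x≢c) (lookup-⊥ x)))

      a∉BC : lookup BC a ≡ false
      a∉BC = trans (lookup-insert-other C a≢b) (trans (lookup-insert-other ⊥ a≢c) (lookup-⊥ a))

      b∉C : lookup C b ≡ false
      b∉C = trans (lookup-insert-other ⊥ b≢c) (lookup-⊥ b)

      ∣Q∣≡4 : ∣ Q ∣ ≡ 4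
      ∣Q∣≡4 = begin
        ∣ Q ∣                      ≡⟨ card-insert x I x∉I ⟩
        1 + ∣ I ∣                  ≡⟨ cong (1 +_) (card-insert a BC a∉BC) ⟩
        2 + ∣ BC ∣                 ≡⟨ cong (2 +_) (card-insert b C b∉C) ⟩
        3 + ∣ C ∣                  ≡⟨ cong (3 +_) (card-insert c ⊥ (lookup-⊥ c)) ⟩
        4 + ∣ ⊥ {n = v} ∣          ≡⟨ cong (4 +_) (∣⊥∣≡0 v) ⟩
        4                          ∎
        where open ≡-Reasoning

      adj-I : ∀ y → lookup I y ≡ true → adj G y x ≡ adj G x a
      adj-I y y∈I with lookup-insert⁻ y a BC y∈I
      ... | inj₁ refl = Graph.sym G a x
      ... | inj₂ y∈bc with lookup-insert⁻ y b C y∈bc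
      ...   | inj₁ refl = trans (Graph.sym G b x) (sym xa≡xb)
      ...   | inj₂ y∈c with lookup-insert⁻ y c ⊥ y∈c
      ...     | inj₁ refl = trans (Graph.sym G c x) (sym xa≡xc)
      ...     | inj₂ y∈⊥ with trans (sym (lookup-⊥ y)) y∈⊥
      ...       | ()

      interval : IsInterval G Q I
      interval = (λ {y} y∈I → lookup⇒∈ (lookup-insert⁺ y x I (∈⇒lookup y∈I))) , same-adjacency
        where
        -- the only vertex of Q outside I is x
        same-adjacency : ∀ y z w → y ∈ I → z ∈ I → w ∈ Q → w ∉ I → adj G y w ≡ adj G z w
        same-adjacency y z w y∈I z∈I w∈Q w∉I with lookup-insert⁻ w x I (∈⇒lookup w∈Q)
        ... | inj₁ refl = trans (adj-I y (∈⇒lookup y∈I)) (sym (adj-I z (∈⇒lookup z∈I)))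
        ... | inj₂ w∈I = ⊥-elim (w∉I (lookup⇒∈ w∈I))

      a∈I : a ∈ I
      a∈I = lookup⇒∈ (lookup-insert a BC)

      b∈I : b ∈ I
      b∈I = lookup⇒∈ (lookup-insert⁺ b a BC (lookup-insert b C))

      nontrivial : ¬ IsTrivial Q I
      nontrivial (inj₁ I-empty) = I-empty a a∈I
      nontrivial (inj₂ (inj₁ (y , I≡⁅y⁆))) =
        a≢b (trans (x∈⁅y⁆⇒x≡y y (subst (a ∈_) I≡⁅y⁆ a∈I)) (sym (x∈⁅y⁆⇒x≡y y (subst (b ∈_) I≡⁅y⁆ b∈I))))
      nontrivial (inj₂ (inj₂ I≡Q)) with trans (sym x∉I) (trans (cong (λ X → lookup X x) I≡Q) (lookup-insert x I))
      ... | ()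

    decomposable-quadruple : Σ (Subset v) λ T → ∣ T ∣ ≡ 4 × ¬ Indecomposable G T
    decomposable-quadruple = Q , ∣Q∣≡4 , λ indecomposable → nontrivial (indecomposable I interval)

  private
    vertex : ∀ {w} → Fin 5 → Fin (6 + w)
    vertex {w} i = suc (i ↑ˡ w)

    vertex-injective : ∀ {w i j} → vertex {w} i ≡ vertex j → i ≡ j
    vertex-injective {w} {i} {j} = ↑ˡ-injective w i j ∘ suc-injective

  -- Every graph on at least six vertices has a decomposable 4-set: some three of the
  -- vertices 1, …, 5 have the same adjacency to vertex 0.
  decomposable-4-set : ∀ {v} → 6 ≤ v → (G : Graph v) → Σ (Subset v) λ T → ∣ T ∣ ≡ 4 × ¬ Indecomposable G T
  decomposable-4-set {v = suc (suc (suc (suc (suc (suc w)))))} (s≤s (s≤s (s≤s (s≤s (s≤s (s≤s _)))))) G =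
    from-alike (three-alike (tabulate adj₀))
    where
    adj₀ : Fin 5 → Bool
    adj₀ i = adj G zero (vertex i)
    agrees : ∀ {i j} → lookup (tabulate adj₀) i ≡ lookup (tabulate adj₀) j → adj₀ i ≡ adj₀ j
    agrees {i} {j} e = trans (sym (lookup∘tabulate adj₀ i)) (trans e (lookup∘tabulate adj₀ j))
    from-alike : ThreeAlike (tabulate adj₀) → Σ (Subset (6 + w)) λ T → ∣ T ∣ ≡ 4 × ¬ Indecomposable G T
    from-alike (i , j , l , i≢j , i≢l , j≢l , bi≡bj , bi≡bl) =
      decomposable-quadruple G zero (vertex i) (vertex j) (vertex l) (λ ()) (λ ()) (λ ())
        (i≢j ∘ vertex-injective) (i≢l ∘ vertex-injective) (j≢l ∘ vertex-injective)
        (agrees bi≡bj) (agrees bi≡bl)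

open import Data.Nat using (ℕ)
open import Defs using (Graph)

module GraphComparison {v : ℕ} (G G' : Graph v) where

  open import Data.Nat as ℕ using (z≤n; s≤s; _≤_)
  open import Data.Nat.Combinatorics using (_C_)
  import Data.Nat.Divisibility as ℕ∣
  open import Data.Bool using (Bool; true; false; _∧_; _xor_)
  import Data.Bool as Bool
  open import Data.Nat.Properties using (≡ᵇ⇒≡)
  open import Data.Fin.Subset using (Subset; ∣_∣; ⊥)
  open import Data.Fin.Subset.Properties using (_⊆?_; ∣⊥∣≡0)
  open import Data.Integer using (ℤ; +_; _+_; _*_; -_; _-_)
  open import Data.Integer.Properties using (+-inverseʳ)
  open import Data.Integer.Tactic.RingSolver using (solve-∀)
  open import Data.Integer.Divisibility.Signed using (_∣_; divides; ∣ᵤ⇒∣; ∣⇒∣ᵤ; ∣m⇒∣-m; ∣m∣n⇒∣m+n; ∣m∣n⇒∣m-n)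
  open import Data.Product using (_,_)
  open import Data.Sum using (_⊎_; inj₁; inj₂)
  open import Data.Empty using (⊥-elim)
  open import Function using (_∘_; const)
  open import Function.Bundles using (_⇔_; mk⇔)
  open import Relation.Nullary using (¬_; Dec; yes; no; does)
  open import Relation.Nullary.Decidable using (dec-false)
  open import Relation.Binary.PropositionalEquality
  open import Defs using (Indecomposable; indecomposable?; indecSet4?; p4; _≡_[mod_])
  open SubsetSums
  open BitSubsets
  open Binomials
  open Reconstruction
  open DecomposableSets

  isIndec4 : Graph v → Subset v → Bool
  isIndec4 H T = (∣ T ∣ ℕ.≡ᵇ 4) ∧ does (indecomposable? H T)

  F : Subset v → ℤ
  F T = ⟦ isIndec4 G T ⟧ - ⟦ isIndec4 G' T ⟧

  F-on-4-sets : ∀ T → F T ≡ + 0 ⊎ ∣ T ∣ ≡ 4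
  F-on-4-sets T with ∣ T ∣ ℕ.≡ᵇ 4 in ∣T∣≡ᵇ4
  ... | true = inj₂ (≡ᵇ⇒≡ ∣ T ∣ 4 (subst Bool.T (sym ∣T∣≡ᵇ4) _))
  ... | false = inj₁ refl

  p4-as-∑ : ∀ H K → + p4 H K ≡ ∑[ T ] (⟦ T ⊆ᵇ K ⟧ * ⟦ isIndec4 H T ⟧)
  p4-as-∑ H K = trans (count-as-∑ (indecSet4? H K)) (∑-cong λ T →
    trans (⟦⟧-∧ (does (T ⊆? K)) (isIndec4 H T)) (cong (λ b → ⟦ b ⟧ * ⟦ isIndec4 H T ⟧) (⊆ᵇ-does T K)))

  p4-difference : ∀ K → + p4 G K - + p4 G' K ≡ ∑[ T ] (⟦ T ⊆ᵇ K ⟧ * F T)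
  p4-difference K = begin
    + p4 G K - + p4 G' K
      ≡⟨ cong₂ _-_ (p4-as-∑ G K) (p4-as-∑ G' K) ⟩
    ∑[ T ] (⟦ T ⊆ᵇ K ⟧ * ⟦ isIndec4 G T ⟧) - ∑[ T ] (⟦ T ⊆ᵇ K ⟧ * ⟦ isIndec4 G' T ⟧)
      ≡⟨ sym (∑-- (λ T → ⟦ T ⊆ᵇ K ⟧ * ⟦ isIndec4 G T ⟧) (λ T → ⟦ T ⊆ᵇ K ⟧ * ⟦ isIndec4 G' T ⟧)) ⟩
    ∑[ T ] (⟦ T ⊆ᵇ K ⟧ * ⟦ isIndec4 G T ⟧ - ⟦ T ⊆ᵇ K ⟧ * ⟦ isIndec4 G' T ⟧)
      ≡⟨ ∑-cong (λ T → factor ⟦ T ⊆ᵇ K ⟧ ⟦ isIndec4 G T ⟧ ⟦ isIndec4 G' T ⟧) ⟩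
    ∑[ T ] (⟦ T ⊆ᵇ K ⟧ * F T) ∎
    where
    open ≡-Reasoning
    factor : ∀ a x y → a * x - a * y ≡ a * (x - y)
    factor = solve-∀

  equal-counts⇒ : ∀ {k} → (∀ K → ∣ K ∣ ≡ k → p4 G K ≡ p4 G' K) →
    ∀ K → ∣ K ∣ ≡ k → + 0 ∣ ∑[ T ] (⟦ T ⊆ᵇ K ⟧ * F T)
  equal-counts⇒ equal K ∣K∣≡k = divides (+ 0) (begin
    ∑[ T ] (⟦ T ⊆ᵇ K ⟧ * F T)   ≡⟨ sym (p4-difference K) ⟩
    + p4 G K - + p4 G' K        ≡⟨ cong (λ n → + n - + p4 G' K) (equal K ∣K∣≡k) ⟩
    + p4 G' K - + p4 G' K       ≡⟨ +-inverseʳ (+ p4 G' K) ⟩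
    + 0 ∎)
    where open ≡-Reasoning

  congruent-counts⇒ : ∀ {p k} → (∀ K → ∣ K ∣ ≡ k → p4 G K ≡ p4 G' K [mod p ]) →
    ∀ K → ∣ K ∣ ≡ k → + p ∣ ∑[ T ] (⟦ T ⊆ᵇ K ⟧ * F T)
  congruent-counts⇒ {p} congruent K ∣K∣≡k = subst (+ p ∣_) (p4-difference K) (∣ᵤ⇒∣ (congruent K ∣K∣≡k))

  Same : Set
  Same = ∀ T → ∣ T ∣ ≡ 4 → (Indecomposable G T ⇔ Indecomposable G' T)

  Complementary : Set
  Complementary = ∀ T → ∣ T ∣ ≡ 4 → (Indecomposable G T ⇔ (¬ Indecomposable G' T))

  private
    isIndec4-on-4-sets : ∀ H T → ∣ T ∣ ≡ 4 → isIndec4 H T ≡ does (indecomposable? H T)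
    isIndec4-on-4-sets H T ∣T∣≡4 rewrite ∣T∣≡4 = refl

    does-≡⇒⇔ : ∀ {P Q : Set} (P? : Dec P) (Q? : Dec Q) → does P? ≡ does Q? → P ⇔ Q
    does-≡⇒⇔ (yes p) (yes q) _ = mk⇔ (const q) (const p)
    does-≡⇒⇔ (no ¬p) (no ¬q) _ = mk⇔ (⊥-elim ∘ ¬p) (⊥-elim ∘ ¬q)

    does-xor⇒⇔¬ : ∀ {P Q : Set} (P? : Dec P) (Q? : Dec Q) → (does P? xor does Q?) ≡ true → P ⇔ (¬ Q)
    does-xor⇒⇔¬ (yes p) (no ¬q) _ = mk⇔ (const ¬q) (const p)
    does-xor⇒⇔¬ (no ¬p) (yes q) _ = mk⇔ (⊥-elim ∘ ¬p) (λ ¬q → ⊥-elim (¬q q))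

    ⟦⟧-injective-mod : ∀ {M} → ¬ M ∣ + 1 → ∀ a b → M ∣ ⟦ a ⟧ - ⟦ b ⟧ → a ≡ b
    ⟦⟧-injective-mod M∤1 true true _ = refl
    ⟦⟧-injective-mod M∤1 false false _ = refl
    ⟦⟧-injective-mod M∤1 true false M∣1 = ⊥-elim (M∤1 M∣1)
    ⟦⟧-injective-mod M∤1 false true M∣-1 = ⊥-elim (M∤1 (∣m⇒∣-m M∣-1))

  same-if-agree : (∀ T → ∣ T ∣ ≡ 4 → isIndec4 G T ≡ isIndec4 G' T) → Same
  same-if-agree agree T ∣T∣≡4 = does-≡⇒⇔ (indecomposable? G T) (indecomposable? G' T)
    (trans (sym (isIndec4-on-4-sets G T ∣T∣≡4)) (trans (agree T ∣T∣≡4) (isIndec4-on-4-sets G' T ∣T∣≡4)))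

  complementary-if-disagree : (∀ T → ∣ T ∣ ≡ 4 → (isIndec4 G T xor isIndec4 G' T) ≡ true) → Complementary
  complementary-if-disagree disagree T ∣T∣≡4 = does-xor⇒⇔¬ (indecomposable? G T) (indecomposable? G' T)
    (trans (cong₂ _xor_ (sym (isIndec4-on-4-sets G T ∣T∣≡4)) (sym (isIndec4-on-4-sets G' T ∣T∣≡4)))
           (disagree T ∣T∣≡4))

  same-from-vanishing : ∀ {M} → ¬ M ∣ + 1 → (∀ T → ∣ T ∣ ≡ 4 → M ∣ F T) → Same
  same-from-vanishing M∤1 vanishes = same-if-agree λ T ∣T∣≡4 → ⟦⟧-injective-mod M∤1 _ _ (vanishes T ∣T∣≡4)

  private
    -- If ⟦a⟧ - ⟦b⟧ is congruent, modulo M ∤ 1, 2, both to a value ≤ 0 and to a value ≥ 0,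
    -- then a = b: otherwise one of the differences would be ±1 or ±2.
    squeeze : ∀ {M} → ¬ M ∣ + 1 → ¬ M ∣ + 2 → ∀ a b c d →
      M ∣ (⟦ a ⟧ - ⟦ b ⟧) - (⟦ false ⟧ - ⟦ c ⟧) → M ∣ (⟦ a ⟧ - ⟦ b ⟧) - (⟦ d ⟧ - ⟦ false ⟧) → a ≡ b
    squeeze _ _ true true _ _ _ _ = refl
    squeeze _ _ false false _ _ _ _ = refl
    squeeze M∤1 _ true false false _ M∣1 _ = ⊥-elim (M∤1 M∣1)
    squeeze _ M∤2 true false true _ M∣2 _ = ⊥-elim (M∤2 M∣2)
    squeeze M∤1 _ false true _ false _ M∣-1 = ⊥-elim (M∤1 (∣m⇒∣-m M∣-1))
    squeeze _ M∤2 false true _ true _ M∣-2 = ⊥-elim (M∤2 (∣m⇒∣-m M∣-2))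

    not-indec4 : ∀ H T → ∣ T ∣ ≡ 4 → ¬ Indecomposable H T → isIndec4 H T ≡ false
    not-indec4 H T ∣T∣≡4 ¬indec = trans (isIndec4-on-4-sets H T ∣T∣≡4) (dec-false (indecomposable? H T) ¬indec)

  -- If F is constant modulo some M ∤ 1, 2 on the 4-sets, it vanishes: compare with a 4-set
  -- decomposable in G (where F ≤ 0) and one decomposable in G' (where F ≥ 0).
  same-from-constancy : ∀ {M} → 6 ≤ v → ¬ M ∣ + 1 → ¬ M ∣ + 2 →
    (∀ T₁ T₂ → ∣ T₁ ∣ ≡ 4 → ∣ T₂ ∣ ≡ 4 → M ∣ F T₁ - F T₂) → Same
  same-from-constancy {M} 6≤v M∤1 M∤2 constant
    with decomposable-4-set 6≤v G | decomposable-4-set 6≤v G'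
  ... | T₁ , ∣T₁∣≡4 , ¬indec₁ | T₂ , ∣T₂∣≡4 , ¬indec₂ = same-if-agree λ T ∣T∣≡4 →
    squeeze M∤1 M∤2 (isIndec4 G T) (isIndec4 G' T) (isIndec4 G' T₁) (isIndec4 G T₂)
      (subst (λ b → M ∣ F T - (⟦ b ⟧ - ⟦ isIndec4 G' T₁ ⟧)) (not-indec4 G T₁ ∣T₁∣≡4 ¬indec₁)
        (constant T T₁ ∣T∣≡4 ∣T₁∣≡4))
      (subst (λ b → M ∣ F T - (⟦ isIndec4 G T₂ ⟧ - ⟦ b ⟧)) (not-indec4 G' T₂ ∣T₂∣≡4 ¬indec₂)
        (constant T T₂ ∣T∣≡4 ∣T₂∣≡4))

  private
    difference≡xor : ∀ a b → + 2 ∣ (⟦ a ⟧ - ⟦ b ⟧) - ⟦ a xor b ⟧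
    difference≡xor true true = divides (+ 0) refl
    difference≡xor true false = divides (+ 0) refl
    difference≡xor false true = divides (- + 1) refl
    difference≡xor false false = divides (+ 0) refl

    xor-false : ∀ a b → (a xor b) ≡ false → a ≡ b
    xor-false true true _ = refl
    xor-false false false _ = refl

    parity-constant : (∀ T₁ T₂ → ∣ T₁ ∣ ≡ 4 → ∣ T₂ ∣ ≡ 4 → + 2 ∣ F T₁ - F T₂) →
      ∀ T₁ T₂ → ∣ T₁ ∣ ≡ 4 → ∣ T₂ ∣ ≡ 4 → (isIndec4 G T₁ xor isIndec4 G' T₁) ≡ (isIndec4 G T₂ xor isIndec4 G' T₂)
    parity-constant constant T₁ T₂ ∣T₁∣≡4 ∣T₂∣≡4 = ⟦⟧-injective-mod (λ 2∣1 → 2∤1 (∣⇒∣ᵤ 2∣1)) _ _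
      (subst (+ 2 ∣_) (regroup (F T₁) (F T₂) ⟦ x₁ ⟧ ⟦ x₂ ⟧)
        (∣m∣n⇒∣m+n (∣m∣n⇒∣m-n (constant T₁ T₂ ∣T₁∣≡4 ∣T₂∣≡4) (difference≡xor (isIndec4 G T₁) (isIndec4 G' T₁)))
                   (difference≡xor (isIndec4 G T₂) (isIndec4 G' T₂))))
      where
      x₁ x₂ : Bool
      x₁ = isIndec4 G T₁ xor isIndec4 G' T₁
      x₂ = isIndec4 G T₂ xor isIndec4 G' T₂
      regroup : ∀ f₁ f₂ y₁ y₂ → ((f₁ - f₂) - (f₁ - y₁)) + (f₂ - y₂) ≡ y₁ - y₂
      regroup = solve-∀
      2∤1 : ¬ 2 ℕ∣.∣ 1
      2∤1 2∣1 with ℕ∣.∣1⇒≡1 2∣1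
      ... | ()

  same-or-complementary : 4 ≤ v → (∀ T₁ T₂ → ∣ T₁ ∣ ≡ 4 → ∣ T₂ ∣ ≡ 4 → + 2 ∣ F T₁ - F T₂) →
    Same ⊎ Complementary
  same-or-complementary 4≤v constant with extend ⊥ 4 (subst (_≤ 4) (sym (∣⊥∣≡0 v)) z≤n) 4≤v
  ... | T₀ , _ , ∣T₀∣≡4 with isIndec4 G T₀ xor isIndec4 G' T₀ in differs₀
  ...   | false = inj₁ (same-if-agree λ T ∣T∣≡4 →
          xor-false _ _ (trans (parity-constant constant T T₀ ∣T∣≡4 ∣T₀∣≡4) differs₀))
  ...   | true = inj₂ (complementary-if-disagree λ T ∣T∣≡4 →
          trans (parity-constant constant T T₀ ∣T∣≡4 ∣T₀∣≡4) differs₀)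

  module _ {p r : ℕ} (euclid : Euclidean p) (avoids : Avoids p r) (k+4≤v : 4 ℕ.+ r ℕ.+ 4 ≤ v)
    (hyp : ∀ K → ∣ K ∣ ≡ 4 ℕ.+ r → + p ∣ ∑[ T ] (⟦ T ⊆ᵇ K ⟧ * F T)) where

    F-constant-mod : ∀ T₁ T₂ → ∣ T₁ ∣ ≡ 4 → ∣ T₂ ∣ ≡ 4 → + p ∣ F T₁ - F T₂
    F-constant-mod = F-constant (+ p) (4 ℕ.+ r) F F-on-4-sets hyp (avoids-cancels euclid avoids)
      (s≤s (s≤s (s≤s (s≤s z≤n)))) k+4≤v

    F-vanishes-mod : ¬ p ℕ∣.∣ (4 ℕ.+ r) C 4 → ∀ T → ∣ T ∣ ≡ 4 → + p ∣ F T
    F-vanishes-mod p∤C₄ = F-vanishes (+ p) (4 ℕ.+ r) F F-on-4-sets hyp (avoids-cancels euclid avoids)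
      (s≤s (s≤s (s≤s (s≤s z≤n)))) k+4≤v (euclidean-cancels euclid p∤C₄)

open import Defs
open import Data.Nat using (ℕ; _≤_; _∸_; _+_)
open import Data.Nat.Divisibility using (_∣_)
open import Data.Nat.Primality using (Prime)
open import Data.Fin.Subset using (Subset; ∣_∣)
open import Data.Product using (_×_)
open import Data.Sum using (_⊎_)
open import Relation.Nullary using (¬_)
open import Relation.Binary.PropositionalEquality using (_≡_)
open import Function.Bundles using (_⇔_)

open import Data.Nat using (_*_; z≤n; s≤s)
open import Data.Nat.Properties using (≤-trans; ≤-refl; m≤n+m)
open import Data.Nat.Divisibility using (divides; ∣-trans)
open import Data.Product using (_,_)
open import Data.Sum using (inj₁; inj₂)
open import Function using (_∘_)
open import Relation.Binary.PropositionalEquality using (refl; trans; cong; subst)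
import Relation.Binary.PropositionalEquality as ≡
import Data.Integer as ℤ
import Data.Integer.Divisibility.Signed as ℤ∣
open import Data.Integer.Properties using (pos-+)
import Data.Integer.Tactic.RingSolver as ℤSolver
open SubsetSums using (∑; ⟦_⟧)
open BitSubsets using (_⊆ᵇ_)
open Binomials

private
  ∤⇒∤ℤ : ∀ {p n} → ¬ p ∣ n → ¬ (ℤ.+ p) ℤ∣.∣ (ℤ.+ n)
  ∤⇒∤ℤ p∤n p∣n = p∤n (ℤ∣.∣⇒∣ᵤ p∣n)

  congruent-by : ∀ {p} j n → p ∣ n → (j + n) ≡ j [mod p ]
  congruent-by {p} j n p∣n = subst (λ z → p ∣ ℤ.∣ z ∣) (≡.sym (difference j n)) p∣n
    where
    cancel : ∀ a b → (a ℤ.+ b) ℤ.- a ≡ b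
    cancel = ℤSolver.solve-∀
    difference : ∀ j n → ℤ.+ (j + n) ℤ.- ℤ.+ j ≡ ℤ.+ n
    difference j n = trans (cong (ℤ._- ℤ.+ j) (pos-+ j n)) (cancel (ℤ.+ j) (ℤ.+ n))

  6≤ : ∀ {r v} → 4 + r + 4 ≤ v → 6 ≤ v
  6≤ {r} k+4≤v = ≤-trans (s≤s (s≤s (s≤s (s≤s (≤-trans (s≤s (s≤s z≤n)) (m≤n+m 4 r)))))) k+4≤v

-- Part 1: equal counts on the k-sets determine the indecomposable 4-sets.  This is the
-- modulus 0, which has Euclid's property and divides no positive number.
equal-counts-case : ∀ {v} (G G' : Graph v) r → 4 + r + 4 ≤ v →
  (∀ (K : Subset v) → ∣ K ∣ ≡ 4 + r → p4 G K ≡ p4 G' K) → GraphComparison.Same G G'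
equal-counts-case G G' r k+4≤v equal = same-from-constancy (6≤ k+4≤v) (∤⇒∤ℤ 0∤suc) (∤⇒∤ℤ 0∤suc)
  (F-constant-mod zero-euclidean (avoids-by-factors r zero-euclidean 0∤suc 0∤suc 0∤suc 0∤suc) k+4≤v
    (equal-counts⇒ equal))
  where open GraphComparison G G'

module _ {v} (G G' : Graph v) (p r : ℕ) (p-prime : Prime p) (k+4≤v : 4 + r + 4 ≤ v)
  (congruent : ∀ (K : Subset v) → ∣ K ∣ ≡ 4 + r → p4 G K ≡ p4 G' K [mod p ]) where

  open GraphComparison G G'

  private
    euclid : Euclidean p
    euclid = prime⇒euclidean p-prime

    hyp : ∀ K → ∣ K ∣ ≡ 4 + r → ℤ.+ p ℤ∣.∣ ∑[ T ] (⟦ T ⊆ᵇ K ⟧ ℤ.* F T)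
    hyp = congruent-counts⇒ congruent

  -- Part 2a: a prime p ≥ 5 with k ≢ 1, 2, 3 (mod p) divides none of k-1, k-2, k-3,
  -- hence avoids k; and p divides neither 1 nor 2.
  large-prime-case : 5 ≤ p → ¬ ((4 + r) ≡ 1 [mod p ]) → ¬ ((4 + r) ≡ 2 [mod p ]) → ¬ ((4 + r) ≡ 3 [mod p ]) → Same
  large-prime-case 5≤p k≢1 k≢2 k≢3 =
    same-from-constancy (6≤ k+4≤v) (∤⇒∤ℤ (prime∤1 p-prime)) (∤⇒∤ℤ (≥3∤2 (≤-trans 3≤5 5≤p)))
      (F-constant-mod euclid avoids k+4≤v hyp)
    where
    3≤5 : 3 ≤ 5
    3≤5 = s≤s (s≤s (s≤s z≤n))
    avoids : Avoids p r
    avoids = avoids-by-factors r euclid (prime∤1 p-prime)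
      (k≢3 ∘ congruent-by 3 (1 + r)) (k≢2 ∘ congruent-by 2 (2 + r)) (k≢1 ∘ congruent-by 1 (3 + r))

  -- Part 2b: p = 2 with k = 4 + 4t, t even (2 avoids k and C(k, 4) is odd, so F vanishes
  -- mod 2), or p = 3 with k = 4 + 3s, 9 ∤ k - 1 (3 avoids k).
  small-prime-case : ((p ≡ 2) × (4 ∣ 4 + r) × ¬ (8 ∣ 4 + r)) ⊎ ((p ≡ 3) × (3 ∣ 3 + r) × ¬ (9 ∣ 3 + r)) → Same
  small-prime-case (inj₁ (refl , 4∣k , 8∤k)) with multiple-of-4 r 4∣k
  ... | t , refl = same-from-vanishing (∤⇒∤ℤ (prime∤1 p-prime))
    (F-vanishes-mod euclid (avoids-two t) k+4≤v hyp (two-∤C₄ t (8∤⇒2∤ t 8∤k)))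
  small-prime-case (inj₂ (refl , 3∣k-1 , 9∤k-1)) with multiple-of-3 r 3∣k-1
  ... | s , refl = same-from-constancy (6≤ k+4≤v) (∤⇒∤ℤ (prime∤1 p-prime)) (∤⇒∤ℤ (≥3∤2 ≤-refl))
    (F-constant-mod euclid (avoids-three s (9∤⇒3∤ s 9∤k-1)) k+4≤v hyp)

  -- Part 2c: p = 2 and 8 ∣ k: 2 still avoids k, so F is constant modulo 2.
  two-eight-case : p ≡ 2 → 8 ∣ 4 + r → Same ⊎ Complementary
  two-eight-case refl 8∣k with multiple-of-4 r (∣-trans (divides 2 refl) 8∣k)
  ... | t , refl = same-or-complementary (≤-trans (m≤n+m 4 (4 + t * 4)) k+4≤v)
    (F-constant-mod euclid (avoids-two t) k+4≤v hyp)

theorem4p2 : (v : ℕ) (G G' : Graph v) (p k : ℕ) → Prime p → 4 ≤ k → k + 4 ≤ v →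
    ((∀ (K : Subset v) → ∣ K ∣ ≡ k → p4 G K ≡ p4 G' K) →
      ∀ (T : Subset v) → ∣ T ∣ ≡ 4 → (Indecomposable G T ⇔ Indecomposable G' T))
    × ((∀ (K : Subset v) → ∣ K ∣ ≡ k → p4 G K ≡ p4 G' K [mod p ]) →
      ((5 ≤ p → ¬ (k ≡ 1 [mod p ]) → ¬ (k ≡ 2 [mod p ]) → ¬ (k ≡ 3 [mod p ]) →
          ∀ (T : Subset v) → ∣ T ∣ ≡ 4 → (Indecomposable G T ⇔ Indecomposable G' T))
       × ((((p ≡ 2) × (4 ∣ k) × ¬ (8 ∣ k)) ⊎ ((p ≡ 3) × (3 ∣ k ∸ 1) × ¬ (9 ∣ k ∸ 1))) →
          ∀ (T : Subset v) → ∣ T ∣ ≡ 4 → (Indecomposable G T ⇔ Indecomposable G' T))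
       × (p ≡ 2 → 8 ∣ k →
          (∀ (T : Subset v) → ∣ T ∣ ≡ 4 → (Indecomposable G T ⇔ Indecomposable G' T))
          ⊎ (∀ (T : Subset v) → ∣ T ∣ ≡ 4 → (Indecomposable G T ⇔ (¬ Indecomposable G' T))))))
theorem4p2 v G G' p k p-prime (s≤s (s≤s (s≤s (s≤s (z≤n {r}))))) k+4≤v =
  equal-counts-case G G' r k+4≤v , λ congruent →
    large-prime-case G G' p r p-prime k+4≤v congruent ,
    small-prime-case G G' p r p-prime k+4≤v congruent ,
    two-eight-case G G' p r p-prime k+4≤v congruent
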